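{- Let $G=(V,E)$ be an undirected graph on $n$ vertices with edge weights $w:E\to\{0,1,\dots,W\}$, let $r$ be a VC-SNDP requirement function on $G$ with maximum requirement $k=\max_{u,v} r(uv)$, and let $t\ge 1$ be an integer. Let $H$ be the output of the streaming greedy vertex-fault-tolerant spanner algorithm (described in the context) run on the edges of $G$, presented in an arbitrary order, with parameters $t$, $f=(2t-2)(k-1)$ and $\epsilon=1/(2t-1)$. Then the minimum weight of a feasible solution of the VC-SNDP instance $(H,r)$ is at most $2tk$ times the minimum weight of a feasible solution of the VC-SNDP instance $(G,r)$.
   Context: VC-SNDP: given an undirected graph $G=(V,E)$ with nonnegative edge weights and an integer requirement $r(uv)\ge 0$ for each unordered pair $u,v\in V$, a feasible solution is a subgraph $H'\subseteq G$ (edge subset) such that for every pair $u,v$, $H'$ contains $r(uv)$ internally vertex-disjoint $uv$-paths; the goal is to minimize the total weight of $H'$. We assume the instance on $G$ is feasible. Streaming greedy vertex-fault-tolerant (VFT) spanner algorithm with parameters $(t,f,\epsilon)$: partition possible weights into buckets $B_0=\{0\}$ and $B_i=[(1+\epsilon)^{i-1},(1+\epsilon)^{i})$ for $i=1,\dots,T$ with $T=O(\epsilon^{ -1}\log W)$ large enough to cover $\{1,\dots,W\}$. Initialize $H_i=(V,\emptyset)$ for every bucket $i$. Process the edges one at a time in the stream order; for an edge $(u,v)$ with $w(u,v)\in B_j$, add $(u,v)$ to $H_j$ if there exists a set $F\subseteq V\setminus\{u,v\}$ of at most $f$ vertices such that $d_{H_j\setminus F}(u,v)>2t-1$, where $d$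 denotes unweighted (hop) distance ($\infty$ if disconnected) and $H_j\setminus F$ is the subgraph induced on $V\setminus F$. Output $H=H_0\cup H_1\cup\dots\cup H_T$. -}

module Defs where

open import Data.Nat using (ℕ; zero; suc; _+_; _*_; _∸_; _^_; _≤_; _<_)
open import Data.Fin using (Fin)
open import Data.List using (List; []; _∷_; _++_; [_]; length; map)
open import Data.Nat.ListAction using (sum)
open import Data.Maybe using (just)
open import Data.Product using (Σ; ∃; ∃-syntax; _×_; _,_; proj₁; proj₂)
open import Data.Sum using (_⊎_)
open import Data.Empty using (⊥)
open import Relation.Nullary using (¬_)
open import Relation.Binary.PropositionalEquality using (_≡_; _≢_)
open import Data.List.Membership.Propositional using (_∈_; _∉_)
open import Data.List.Relation.Unary.All using (All)
open import Data.List.Relation.Unary.Unique.Propositional using (Unique)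

-- An edge is an (oriented representative of an) unordered pair of vertices.
Edge : ℕ → Set
Edge n = Fin n × Fin n

SimpleEdgeList : ∀ {n} → List (Edge n) → Set
SimpleEdgeList {n} es =
  All (λ e → proj₁ e ≢ proj₂ e) es × Unique es ×
  (∀ (a b : Fin n) → (a , b) ∈ es → (b , a) ∉ es)

Adj : ∀ {n} → List (Edge n) → Fin n → Fin n → Set
Adj es a b = (a , b) ∈ es ⊎ (b , a) ∈ es

data IsWalk {n} (R : Fin n → Fin n → Set) : List (Fin n) → Fin n → Fin n → Set where
  single : ∀ {u} → IsWalk R (u ∷ []) u u
  step   : ∀ {u x xs v} → R u x → IsWalk R (x ∷ xs) x v → IsWalk R (u ∷ x ∷ xs) u v

IsPath : ∀ {n} → (Fin n → Fin n → Set) → List (Fin n) → Fin n → Fin n → Set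
IsPath R xs u v = IsWalk R xs u v × Unique xs

InternallyDisjoint : ∀ {n} → Fin n → Fin n → List (Fin n) → List (Fin n) → Set
InternallyDisjoint {n} u v p q = ∀ (x : Fin n) → x ∈ p → x ∈ q → x ≡ u ⊎ x ≡ v

HasDisjointPaths : ∀ {n} → List (Edge n) → Fin n → Fin n → ℕ → Set
HasDisjointPaths {n} es u v m =
  Σ (Fin m → List (Fin n)) λ ps →
    (∀ i → IsPath (Adj es) (ps i) u v) ×
    (∀ i j → i ≢ j → ps i ≢ ps j × InternallyDisjoint u v (ps i) (ps j))

Feasible : ∀ {n} → List (Edge n) → (Fin n → Fin n → ℕ) → Set
Feasible {n} es r = ∀ (u v : Fin n) → u ≢ v → HasDisjointPaths es u v (r u v)

weight : ∀ {n} → (Fin n → Fin n → ℕ) → List (Edge n) → ℕ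
weight w es = sum (map (λ e → w (proj₁ e) (proj₂ e)) es)

IsMaxReq : ∀ {n} → (Fin n → Fin n → ℕ) → ℕ → Set
IsMaxReq {n} r k =
  (∀ (u v : Fin n) → u ≢ v → r u v ≤ k) ×
  (k ≡ 0 ⊎ Σ (Fin n) λ u → Σ (Fin n) λ v → u ≢ v × r u v ≡ k)

-- Weight buckets for ε = num/den (den ≥ 1), so 1+ε = (den+num)/den:
-- B_0 = {0}, B_i = [(1+ε)^(i-1), (1+ε)^i) for i ≥ 1, cleared of denominators.
InBucket : ℕ → ℕ → ℕ → ℕ → Set
InBucket num den w zero    = w ≡ 0
InBucket num den w (suc i) =
  ((den + num) ^ i ≤ w * den ^ i) × (w * den ^ suc i < (den + num) ^ suc i)

AdjBucket : ∀ {n} → (Fin n → Fin n → ℕ) → ℕ → ℕ → List (Edge n) → ℕ → Fin n → Fin n → Set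
AdjBucket w num den acc j a b =
  Σ (Edge _) λ e → e ∈ acc × InBucket num den (w (proj₁ e) (proj₂ e)) j ×
    ((e ≡ (a , b)) ⊎ (e ≡ (b , a)))

-- The greedy test for edge (u,v) w.r.t. the already-added edges acc:
-- there is F ⊆ V∖{u,v}, |F| ≤ f, such that the hop distance from u to v in
-- H_j ∖ F exceeds 2t-1 (j = bucket of w(u,v)), i.e. there is no walk from u
-- to v in H_j avoiding F with at most 2t-1 edges.
AddTest : ∀ {n} → (Fin n → Fin n → ℕ) → (t f num den : ℕ) → List (Edge n) → Edge n → Set
AddTest {n} w t f num den acc (u , v) =
  Σ ℕ λ j → InBucket num den (w u v) j ×
  Σ (List (Fin n)) λ F → length F ≤ f × u ∉ F × v ∉ F ×
    ¬ (Σ (List (Fin n)) λ xs → IsWalk (AdjBucket w num den acc j) xs u v ×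
         All (λ x → x ∉ F) xs × length xs ∸ 1 ≤ 2 * t ∸ 1)

-- Run w t f num den acc stream out : processing 'stream' starting from the
-- already-added edges acc (union of all H_i) ends with output out.
data Run {n} (w : Fin n → Fin n → ℕ) (t f num den : ℕ) :
         List (Edge n) → List (Edge n) → List (Edge n) → Set where
  done : ∀ {acc} → Run w t f num den acc [] acc
  add  : ∀ {acc e es out} → AddTest w t f num den acc e →
         Run w t f num den (acc ++ [ e ]) es out → Run w t f num den acc (e ∷ es) out
  skip : ∀ {acc e es out} → ¬ AddTest w t f num den acc e →
         Run w t f num den acc es out → Run w t f num den acc (e ∷ es) out

-- Let OPT be a feasible solution inside G. An edge x y of OPT missing from H was rejected
-- by the greedy test, so for every set F of at most f = (2t-2)(k-1) other vertices, H
-- contains an x–y walk avoiding F with at most 2t-1 edges, all in the weight bucket of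
-- x y. Taking F to be the union of the interiors of the walks found so far yields k
-- internally disjoint such detours, each of weight at most 2t·w(x y), since weights within
-- a bucket differ by a factor below 1 + 1/(2t-1). Let H′ consist of the edges of H that
-- lie in OPT or on these detours; its weight is at most 2tk·w(OPT).
--
-- H′ is feasible by Menger's theorem: if a set Z of fewer than r(u v) ≤ k vertices other
-- than u, v is given, one of the r(u v) internally disjoint u–v paths of OPT avoids Z, and
-- each of its edges can be replaced by one of its k disjoint detours that avoids Z. The
-- edge u v, if present, carries only one of the paths, so it must not be used there.
-- Menger's theorem itself is proved for vertex sets A, B by induction on the edge list.

module Submission where

open import Defs
open import Data.Nat using (ℕ; zero; suc; _+_; _*_; _∸_; _^_; _≤_; _<_; z≤n; s≤s; _≤?_; _<?_; NonZero; >-nonZero)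
open import Data.Nat.Properties
open import Data.Nat.ListAction using (sum)
open import Data.Nat.ListAction.Properties using (sum-++)
open import Data.Nat.Tactic.RingSolver using (solve-∀)
open import Data.Fin using (Fin; zero; suc; inject≤; punchOut) renaming (_≟_ to _≟ᶠ_)
open import Data.Fin.Properties using (any?; injective⇒≤; punchOut-injective; inject≤-injective)
  renaming (suc-injective to suc-injectiveᶠ)
open import Data.List using (List; []; _∷_; _++_; [_]; length; map; reverse; drop; lookup; filter; allFin; concat; tabulate)
open import Data.List.Properties
  using (length-drop; unfold-reverse; ++-assoc; ++-identityʳ; length-++; filter-notAll; map-++) renaming (≡-dec to List-≡-dec)
open import Data.List.Relation.Unary.Any as Any using (Any; here; there; index)
open import Data.List.Relation.Unary.Any.Properties using (lookup-index; reverse⁻)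
open import Data.List.Relation.Unary.All as All using (All; []; _∷_)
open import Data.List.Relation.Unary.All.Properties using (¬Any⇒All¬) renaming (++⁺ to All-++⁺)
open import Data.List.Relation.Unary.AllPairs using ([]; _∷_)
open import Data.List.Relation.Unary.Linked using (Linked; []; [-]; _∷_)
open import Data.List.Relation.Unary.Unique.Propositional using (Unique)
open import Data.List.Relation.Unary.Unique.Propositional.Properties using (drop⁺; filter⁺; allFin⁺)
open import Data.List.Membership.Propositional using (_∈_; _∉_; find; lose)
open import Data.List.Membership.Propositional.Properties
  using (∈-allFin; ∈-lookup; ∈-++⁺ˡ; ∈-++⁺ʳ; ∈-++⁻; ∈-filter⁺; ∈-filter⁻; ∈-concat⁺′; ∈-tabulate⁺)
open import Data.List.Relation.Binary.Subset.Propositional using () renaming (_⊆_ to _⊆ₘ_)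
open import Data.List.Relation.Binary.Subset.Propositional.Properties using (All-resp-⊇)
open import Data.List.Relation.Binary.Sublist.Propositional using (_⊆_; []; _∷_; _∷ʳ_; minimum; ⊆-trans)
open import Data.List.Relation.Binary.Sublist.Propositional.Properties using (All-resp-⊆; Any-resp-⊆; filter-⊆; drop-⊆)
open import Data.Product using (Σ; _×_; _,_; proj₁; proj₂)
open import Data.Product.Properties using () renaming (≡-dec to ×-≡-dec)
open import Data.Sum using (_⊎_; inj₁; inj₂; map₂)
open import Data.Unit using (⊤; tt)
open import Data.Empty using (⊥; ⊥-elim)
open import Relation.Nullary using (¬_; Dec; yes; no)
open import Relation.Nullary.Decidable using (_×-dec_; _⊎-dec_; ¬?)
open import Relation.Binary.PropositionalEquality using (_≡_; _≢_; refl; sym; trans; cong; subst; subst₂)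

-- Walks

_∈?_ : ∀ {n} (x : Fin n) (xs : List (Fin n)) → Dec (x ∈ xs)
x ∈? xs = Any.any? (x ≟ᶠ_) xs

++-⊆ₘ : ∀ {a} {A : Set a} {xs ys zs : List A} → xs ⊆ₘ zs → ys ⊆ₘ zs → xs ++ ys ⊆ₘ zs
++-⊆ₘ {xs = xs} xs⊆ ys⊆ m with ∈-++⁻ xs m
... | inj₁ p = xs⊆ p
... | inj₂ p = ys⊆ p

module _ {n : ℕ} {R : Fin n → Fin n → Set} where

  private
    V = Fin n

  walk-head : ∀ {xs u v} → IsWalk R xs u v → u ∈ xs
  walk-head single = here refl
  walk-head (step _ _) = here refl

  walk-last : ∀ {xs u v} → IsWalk R xs u v → v ∈ xs
  walk-last single = here refl
  walk-last (step _ w) = there (walk-last w)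

  walk-nonempty : ∀ {xs u v} → IsWalk R xs u v → 1 ≤ length xs
  walk-nonempty single = s≤s z≤n
  walk-nonempty (step _ _) = s≤s z≤n

  walk-∷ : ∀ {u x ys z} → R u x → IsWalk R ys x z → IsWalk R (u ∷ ys) u z
  walk-∷ r single = step r single
  walk-∷ r (step r' w) = step r (step r' w)

  walk-++ : ∀ {xs ys u v z} → IsWalk R xs u v → IsWalk R (v ∷ ys) v z → IsWalk R (xs ++ ys) u z
  walk-++ single w₂ = w₂
  walk-++ (step r w₁) w₂ = step r (walk-++ w₁ w₂)

  walk-snoc : ∀ {xs u v z} → IsWalk R xs u v → R v z → IsWalk R (xs ++ [ z ]) u z
  walk-snoc w r = walk-++ w (walk-∷ r single)

  walk-join : ∀ {xs ys u c v} → IsWalk R xs u c → IsWalk R ys c v →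
    Σ (List V) λ zs → IsWalk R zs u v × zs ⊆ₘ xs ++ ys
  walk-join w₁ single = _ , w₁ , ∈-++⁺ˡ
  walk-join {xs} w₁ (step r w₂) = _ , walk-++ w₁ (step r w₂) , ++-⊆ₘ ∈-++⁺ˡ (λ m → ∈-++⁺ʳ xs (there m))

  walk-map : ∀ {R′ : V → V → Set} → (∀ {a b} → R a b → R′ a b) →
    ∀ {xs u v} → IsWalk R xs u v → IsWalk R′ xs u v
  walk-map f single = single
  walk-map f (step r w) = step (f r) (walk-map f w)

  walk-reverse : (∀ {a b} → R a b → R b a) → ∀ {xs u v} → IsWalk R xs u v → IsWalk R (reverse xs) v u
  walk-reverse sym-R single = single
  walk-reverse sym-R (step {u} {x} {xs} r w) =
    subst (λ l → IsWalk R l _ u) (sym (unfold-reverse u (x ∷ xs))) (walk-snoc (walk-reverse sym-R w) (sym-R r))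

  walk-prefix : ∀ {xs u v z} → IsWalk R xs u v → z ∈ xs → Σ (List V) λ ys → IsWalk R ys u z × ys ⊆ₘ xs
  walk-prefix single (here refl) = _ , single , (λ m → m)
  walk-prefix (step r w) (here refl) = _ , single , (λ { (here refl) → here refl })
  walk-prefix (step r w) (there p) with walk-prefix w p
  ... | ys , wy , ys⊆ = _ , walk-∷ r wy , (λ { (here refl) → here refl ; (there m) → there (ys⊆ m) })

  walk-suffix : ∀ {ys a b z} → IsWalk R ys a b → z ∈ ys → Σ ℕ λ k → IsWalk R (drop k ys) z b
  walk-suffix single (here refl) = 0 , single
  walk-suffix (step r w) (here refl) = 0 , step r w
  walk-suffix (step r w) (there p) with walk-suffix w p
  ... | k , wk = suc k , wk

  walk-firstHit : ∀ {p} {P : V → Set p} → (∀ x → Dec (P x)) → ∀ {xs u v} → IsWalk R xs u v → Any P xs →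
    P u ⊎ (Σ (List V) λ ps → Σ V λ q → Σ V λ h →
             IsWalk R ps u q × All (λ x → ¬ P x) ps × R q h × P h × ps ⊆ₘ xs × h ∈ xs)
  walk-firstHit P? {u = u} w a with P? u
  ... | yes pu = inj₁ pu
  walk-firstHit P? single (here pu) | no ¬pu = ⊥-elim (¬pu pu)
  walk-firstHit P? (step r w) (here pu) | no ¬pu = ⊥-elim (¬pu pu)
  walk-firstHit P? (step r w) (there a) | no ¬pu with walk-firstHit P? w a
  ... | inj₁ px = inj₂ (_ , _ , _ , single , ¬pu ∷ [] , r , px , (λ { (here refl) → here refl }) , there (here refl))
  ... | inj₂ (ps , q , h , wp , ¬P , rqh , ph , ps⊆ , h∈) =
    inj₂ (_ ∷ ps , q , h , walk-∷ r wp , ¬pu ∷ ¬P , rqh , ph ,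
          (λ { (here refl) → here refl ; (there m) → there (ps⊆ m) }) , there h∈)

  walk-untilFirst : ∀ {p} {P : V → Set p} → (∀ x → Dec (P x)) → ∀ {xs u v} → IsWalk R xs u v → P v →
    Σ (List V) λ qs → Σ V λ h → IsWalk R qs u h × P h × qs ⊆ₘ xs ×
      (∀ {z} → z ∈ qs → z ≡ h ⊎ (Σ (List V) λ ys → IsWalk R ys u z × All (λ x → ¬ P x) ys))
  walk-untilFirst P? w pv with walk-firstHit P? w (lose (walk-last w) pv)
  ... | inj₁ pu = _ , _ , single , pu , (λ { (here refl) → walk-head w }) , (λ { (here refl) → inj₁ refl })
  ... | inj₂ (ps , q , h , wp , ¬P , rqh , ph , ps⊆ , h∈) =
    ps ++ [ h ] , h , walk-snoc wp rqh , ph , ++-⊆ₘ ps⊆ (λ { (here refl) → h∈ }) , before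
    where
    before : ∀ {z} → z ∈ ps ++ [ h ] → _
    before m with ∈-++⁻ ps m
    ... | inj₂ (here refl) = inj₁ refl
    ... | inj₁ z∈ with walk-prefix wp z∈
    ...   | ys , wy , ys⊆ = inj₂ (ys , wy , All-resp-⊇ ys⊆ ¬P)

  walk⇒path : ∀ {xs u v} → IsWalk R xs u v →
    Σ (List V) λ ys → IsWalk R ys u v × Unique ys × ys ⊆ₘ xs × length ys ≤ length xs
  walk⇒path single = _ , single , [] ∷ [] , (λ m → m) , ≤-refl
  walk⇒path (step {u} r w) with walk⇒path w
  ... | ys , wy , uy , ys⊆ , ly with u ∈? ys
  ... | yes u∈ with walk-suffix wy u∈
  ...   | k , wk = drop k ys , wk , drop⁺ k uy , (λ m → there (ys⊆ (Any-resp-⊆ (drop-⊆ k ys) m))) ,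
                   ≤-trans (≤-reflexive (length-drop k ys)) (≤-trans (m∸n≤m (length ys) k) (m≤n⇒m≤1+n ly))
  walk⇒path (step {u} r w) | ys , wy , uy , ys⊆ , ly | no u∉ =
    u ∷ ys , walk-∷ r wy , ¬Any⇒All¬ ys u∉ ∷ uy ,
    (λ { (here refl) → here refl ; (there m) → there (ys⊆ m) }) , s≤s ly

  module _ (R? : ∀ a b → Dec (R a b)) {p} {P : V → Set p} (P? : ∀ x → Dec (P x)) where

    boundedWalk? : ∀ (L : ℕ) (u v : V) → Dec (Σ (List V) λ xs → IsWalk R xs u v × All P xs × length xs ≤ L)
    boundedWalk? zero u v = no λ { (xs , w , _ , le) → 1+n≰n (≤-trans (walk-nonempty w) le) }
    boundedWalk? (suc L) u v with P? u
    ... | no ¬pu = no λ { (xs , w , a , _) → ¬pu (All.lookup a (walk-head w)) }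
    ... | yes pu with u ≟ᶠ v
    ...   | yes refl = yes (_ , single , pu ∷ [] , s≤s z≤n)
    ...   | no u≢v with any? (λ x → R? u x ×-dec boundedWalk? L x v)
    ...     | yes (x , r , xs , w , a , le) = yes (_ , walk-∷ r w , pu ∷ a , s≤s le)
    ...     | no ¬next = no λ { (_ , single , _ , _) → u≢v refl
                              ; (_ ∷ x ∷ xs , step r w , _ ∷ a , s≤s le) → ¬next (x , r , _ , w , a , le) }

module _ {a} {X : Set a} where

  injection-into-list-covers : ∀ (L : List X) {m} (v : Fin m → X) → (∀ i → v i ∈ L) →
    (∀ i j → v i ≡ v j → i ≡ j) → length L ≤ m → ∀ {x} → x ∈ L → Σ (Fin m) λ i → v i ≡ x
  injection-into-list-covers L@(_ ∷ _) {m} v v∈ v-inj L≤m {x} x∈ with any? (λ i → index (v∈ i) ≟ᶠ index x∈)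
  ... | yes (i , eq) = i , trans (lookup-index (v∈ i)) (trans (cong (lookup L) eq) (sym (lookup-index x∈)))
  ... | no ¬hit = ⊥-elim (<⇒≱ L≤m (injective⇒≤ {f = λ i → punchOut (miss i)}
                      λ {i} {j} eq → v-inj i j (trans (lookup-index (v∈ i))
                        (trans (cong (lookup L) (punchOut-injective (miss i) (miss j) eq)) (sym (lookup-index (v∈ j)))))))
    where
    miss : ∀ i → index x∈ ≢ index (v∈ i)
    miss i e = ¬hit (i , sym e)

Unique-lookup-injective : ∀ {a} {X : Set a} {xs : List X} → Unique xs → ∀ i j → lookup xs i ≡ lookup xs j → i ≡ j
Unique-lookup-injective (_ ∷ _) zero zero _ = refl
Unique-lookup-injective (x∉ ∷ _) zero (suc j) eq = ⊥-elim (All.lookup x∉ (∈-lookup j) eq)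
Unique-lookup-injective (x∉ ∷ _) (suc i) zero eq = ⊥-elim (All.lookup x∉ (∈-lookup i) (sym eq))
Unique-lookup-injective (_ ∷ u) (suc i) (suc j) eq = cong suc (Unique-lookup-injective u i j eq)

Unique⇒length≤ : ∀ {n} {xs : List (Fin n)} → Unique xs → length xs ≤ n
Unique⇒length≤ u = injective⇒≤ (Unique-lookup-injective u _ _)

pigeonhole-unblocked : ∀ {m c : ℕ} (Blocked : Fin m → Set) → (∀ i → Dec (Blocked i)) →
  (label : ∀ i → Blocked i → Fin c) → (∀ i j bi bj → label i bi ≡ label j bj → i ≡ j) →
  c < m → Σ (Fin m) λ i → ¬ Blocked i
pigeonhole-unblocked Blocked Blocked? label label-inj c<m with any? (λ i → ¬? (Blocked? i))
... | yes found = found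
... | no none = ⊥-elim (<⇒≱ c<m (injective⇒≤ λ {i} {j} → label-inj i j (blocked i) (blocked j)))
  where
  blocked : ∀ i → Blocked i
  blocked i with Blocked? i
  ... | yes b = b
  ... | no ¬b = ⊥-elim (none (i , ¬b))

module _ {n : ℕ} {R : Fin n → Fin n → Set} (R? : ∀ a b → Dec (R a b))
         {p} {P : Fin n → Set p} (P? : ∀ x → Dec (P x)) where

  -- A shortest walk is a path, so it has at most n vertices.
  walk? : ∀ (u v : Fin n) → Dec (Σ (List (Fin n)) λ xs → IsWalk R xs u v × All P xs)
  walk? u v with boundedWalk? R? P? n u v
  ... | yes (xs , w , all-P , _) = yes (xs , w , all-P)
  ... | no ¬short = no λ (xs , w , all-P) → let (ys , wy , uy , ys⊆ , _) = walk⇒path w in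
                                            ¬short (ys , wy , All-resp-⊇ ys⊆ all-P , Unique⇒length≤ uy)

-- Menger's theorem for vertex sets

module _ {n : ℕ} where

  private
    V = Fin n

  _≟ₑ_ : (d e : Edge n) → Dec (d ≡ e)
  _≟ₑ_ = ×-≡-dec _≟ᶠ_ _≟ᶠ_

  Adj? : (E : List (Edge n)) → ∀ a b → Dec (Adj E a b)
  Adj? E a b = Any.any? ((a , b) ≟ₑ_) E ⊎-dec Any.any? ((b , a) ≟ₑ_) E

  Adj-sym : ∀ {E : List (Edge n)} {a b} → Adj E a b → Adj E b a
  Adj-sym (inj₁ p) = inj₂ p
  Adj-sym (inj₂ p) = inj₁ p

  Adj-∷ : ∀ {e} {E : List (Edge n)} {a b} → Adj E a b → Adj (e ∷ E) a b
  Adj-∷ (inj₁ p) = inj₁ (there p)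
  Adj-∷ (inj₂ p) = inj₂ (there p)

  record Link (E : List (Edge n)) (A B Z : List V) : Set where
    constructor link
    field
      start end : V
      vertices : List V
      start∈ : start ∈ A
      end∈ : end ∈ B
      walk : IsWalk (Adj E) vertices start end
      avoids : All (_∉ Z) vertices

  record Linkage (E : List (Edge n)) (A B : List V) (k : ℕ) : Set where
    field
      route : Fin k → List V
      connects : ∀ i → Σ V λ u → Σ V λ v → u ∈ A × v ∈ B × IsWalk (Adj E) (route i) u v
      disjoint : ∀ i j → i ≢ j → ∀ {x} → x ∈ route i → x ∈ route j → ⊥

  Separator : List (Edge n) → List V → List V → ℕ → Set
  Separator E A B k = Σ (List V) λ Z → length Z < k × ¬ Link E A B Z

  link? : ∀ E A B Z → Dec (Link E A B Z)
  link? E A B Z with Any.any? (λ u → Any.any? (λ v → walk? (Adj? E) (λ x → ¬? (x ∈? Z)) u v) B) A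
  ... | yes found = let (u , u∈ , found′) = find found ; (v , v∈ , xs , w , av) = find found′ in
                    yes (link u v xs u∈ v∈ w av)
  ... | no ¬found = no λ (link u v xs u∈ v∈ w av) → ¬found (lose u∈ (lose v∈ (xs , w , av)))

  link-join : ∀ {E A B Z c} → Link E A [ c ] Z → Link E [ c ] B Z → Link E A B Z
  link-join (link u _ xs u∈ (here refl) w₁ av₁) (link _ v ys (here refl) v∈ w₂ av₂) with walk-join w₁ w₂
  ... | zs , w , zs⊆ = link u v zs u∈ v∈ w (All-resp-⊇ zs⊆ (All-++⁺ av₁ av₂))

  link-reverse : ∀ {E A B Z} → Link E A B Z → Link E B A Z
  link-reverse (link u v xs u∈ v∈ w av) =
    link v u (reverse xs) v∈ u∈ (walk-reverse Adj-sym w) (All-resp-⊇ reverse⁻ av)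

  link-avoids-⊆ : ∀ {E A B Z Z′} → Z′ ⊆ₘ Z → Link E A B Z → Link E A B Z′
  link-avoids-⊆ Z′⊆Z (link u v xs u∈ v∈ w av) = link u v xs u∈ v∈ w (All.map (λ z∉ m → z∉ (Z′⊆Z m)) av)

  start-avoids : ∀ {E B Z c} → Link E [ c ] B Z → c ∉ Z
  start-avoids (link _ _ _ (here refl) _ w av) = All.lookup av (walk-head w)

  end-avoids : ∀ {E A Z c} → Link E A [ c ] Z → c ∉ Z
  end-avoids (link _ _ _ _ (here refl) w av) = All.lookup av (walk-last w)

  IsEdge : V → V → V → V → Set
  IsEdge x y s t = (s ≡ x × t ≡ y) ⊎ (s ≡ y × t ≡ x)

  IsEdge⇒Adj : ∀ {x y E s t} → IsEdge x y s t → Adj ((x , y) ∷ E) s t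
  IsEdge⇒Adj (inj₁ (refl , refl)) = inj₁ (here refl)
  IsEdge⇒Adj (inj₂ (refl , refl)) = inj₂ (here refl)

  IsEdge-sym : ∀ {x y s t} → IsEdge x y s t → IsEdge x y t s
  IsEdge-sym (inj₁ (p , q)) = inj₂ (q , p)
  IsEdge-sym (inj₂ (p , q)) = inj₁ (q , p)

  IsEdge-start : ∀ {x y s t} → IsEdge x y s t → s ≡ x ⊎ s ≡ y
  IsEdge-start (inj₁ (p , _)) = inj₁ p
  IsEdge-start (inj₂ (p , _)) = inj₂ p

  IsEdge-from-distinct-starts : ∀ {x y s t s′ t′} → IsEdge x y s t → IsEdge x y s′ t′ → s ≢ s′ → IsEdge x y s s′
  IsEdge-from-distinct-starts (inj₁ (p , _)) (inj₁ (q , _)) s≢s′ = ⊥-elim (s≢s′ (trans p (sym q)))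
  IsEdge-from-distinct-starts (inj₁ (p , _)) (inj₂ (q , _)) _ = inj₁ (p , q)
  IsEdge-from-distinct-starts (inj₂ (p , _)) (inj₁ (q , _)) _ = inj₂ (p , q)
  IsEdge-from-distinct-starts (inj₂ (p , _)) (inj₂ (q , _)) s≢s′ = ⊥-elim (s≢s′ (trans p (sym q)))

  IsEdge-other-start : ∀ {x y a b s t} → IsEdge x y a b → IsEdge x y s t → s ≢ a → s ≡ b
  IsEdge-other-start (inj₁ (a≡ , b≡)) (inj₁ (s≡ , _)) s≢a = ⊥-elim (s≢a (trans s≡ (sym a≡)))
  IsEdge-other-start (inj₁ (a≡ , b≡)) (inj₂ (s≡ , _)) _ = trans s≡ (sym b≡)
  IsEdge-other-start (inj₂ (a≡ , b≡)) (inj₁ (s≡ , _)) _ = trans s≡ (sym b≡)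
  IsEdge-other-start (inj₂ (a≡ , b≡)) (inj₂ (s≡ , _)) s≢a = ⊥-elim (s≢a (trans s≡ (sym a≡)))

  Adj-∷⁻ : ∀ {x y E s t} → Adj ((x , y) ∷ E) s t → Adj E s t ⊎ IsEdge x y s t
  Adj-∷⁻ (inj₁ (here refl)) = inj₂ (inj₁ (refl , refl))
  Adj-∷⁻ (inj₁ (there p)) = inj₁ (inj₁ p)
  Adj-∷⁻ (inj₂ (here refl)) = inj₂ (inj₂ (refl , refl))
  Adj-∷⁻ (inj₂ (there p)) = inj₁ (inj₂ p)

  walk-avoiding-endpoint : ∀ {x y E c xs u v} → (c ≡ x ⊎ c ≡ y) → c ∉ xs →
    IsWalk (Adj ((x , y) ∷ E)) xs u v → IsWalk (Adj E) xs u v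
  walk-avoiding-endpoint c-end c∉ single = single
  walk-avoiding-endpoint c-end c∉ (step r w) with Adj-∷⁻ r
  ... | inj₁ r′ = step r′ (walk-avoiding-endpoint c-end (λ m → c∉ (there m)) w)
  walk-avoiding-endpoint (inj₁ refl) c∉ (step r w) | inj₂ (inj₁ (refl , refl)) = ⊥-elim (c∉ (here refl))
  walk-avoiding-endpoint (inj₂ refl) c∉ (step r w) | inj₂ (inj₁ (refl , refl)) = ⊥-elim (c∉ (there (walk-head w)))
  walk-avoiding-endpoint (inj₁ refl) c∉ (step r w) | inj₂ (inj₂ (refl , refl)) = ⊥-elim (c∉ (there (walk-head w)))
  walk-avoiding-endpoint (inj₂ refl) c∉ (step r w) | inj₂ (inj₂ (refl , refl)) = ⊥-elim (c∉ (here refl))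

  walk-firstUse : ∀ {x y E xs u v} → IsWalk (Adj ((x , y) ∷ E)) xs u v →
    IsWalk (Adj E) xs u v ⊎
    (Σ (List V) λ ps → Σ V λ s → Σ V λ t → Σ (List V) λ zs →
       IsWalk (Adj E) ps u s × IsEdge x y s t × IsWalk (Adj ((x , y) ∷ E)) zs t v × ps ⊆ₘ xs × zs ⊆ₘ xs)
  walk-firstUse single = inj₁ single
  walk-firstUse (step r w) with Adj-∷⁻ r
  ... | inj₂ st = inj₂ (_ , _ , _ , _ , single , st , w , (λ { (here refl) → here refl }) , there)
  ... | inj₁ r′ with walk-firstUse w
  ...   | inj₁ w′ = inj₁ (step r′ w′)
  ...   | inj₂ (ps , s , t , zs , wp , st , wz , ps⊆ , zs⊆) =
          inj₂ (_ ∷ ps , s , t , zs , walk-∷ r′ wp , st , wz ,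
                (λ { (here refl) → here refl ; (there m) → there (ps⊆ m) }) , (λ m → there (zs⊆ m)))

  link-through-new-edge : ∀ {x y E A B S} → Link ((x , y) ∷ E) A B S → ¬ Link E A B S →
    Σ V λ a → Σ V λ b → IsEdge x y a b × a ≢ b × Link E A [ a ] S × Link E [ b ] B S
  link-through-new-edge (link u v xs u∈ v∈ w av) ¬old with walk-firstUse w
  ... | inj₁ w′ = ⊥-elim (¬old (link u v xs u∈ v∈ w′ av))
  ... | inj₂ (ps , s , t , zs , wp , st , wz , ps⊆ , zs⊆) with walk-firstUse (walk-reverse Adj-sym wz)
  ...   | inj₁ wz′ = s , t , st , (λ { refl → ¬old (link-join toA fromB) }) , toA , fromB
    where
    toA = link u s ps u∈ (here refl) wp (All-resp-⊇ ps⊆ av)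
    fromB = link-reverse (link v t (reverse zs) v∈ (here refl) wz′ (All-resp-⊇ (λ m → zs⊆ (reverse⁻ m)) av))
  ...   | inj₂ (ps′ , s′ , _ , _ , wp′ , st′ , _ , ps′⊆ , _) with s ≟ᶠ s′
  ...     | yes refl = ⊥-elim (¬old (link-join toA fromB))
    where
    toA = link u s ps u∈ (here refl) wp (All-resp-⊇ ps⊆ av)
    fromB = link-reverse (link v s ps′ v∈ (here refl) wp′ (All-resp-⊇ (λ m → zs⊆ (reverse⁻ (ps′⊆ m))) av))
  ...     | no s≢s′ = s , s′ , IsEdge-from-distinct-starts st st′ s≢s′ , s≢s′ , toA , fromB
    where
    toA = link u s ps u∈ (here refl) wp (All-resp-⊇ ps⊆ av)
    fromB = link-reverse (link v s′ ps′ v∈ (here refl) wp′ (All-resp-⊇ (λ m → zs⊆ (reverse⁻ (ps′⊆ m))) av))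

  -- A Z-avoiding A–B walk either meets a ∷ S, and its prefix is an A–(a ∷ S) link, or
  -- misses a, hence the new edge, and is then an S-avoiding A–B link in E.
  separator-survives-new-edge : ∀ {x y E A B S Z a b} → IsEdge x y a b → Link E [ b ] B S →
    ¬ Link E A B S → ¬ Link E A (a ∷ S) Z → ¬ Link ((x , y) ∷ E) A B Z
  separator-survives-new-edge {S = S} {a = a} ab fromB ¬S ¬Z (link u v xs u∈ v∈ w avZ)
    with Any.any? (_∈? (a ∷ S)) xs
  ... | no ¬meets = ¬S (link u v xs u∈ v∈ (old-walk ¬aS w) (All.map (λ z∉ m → z∉ (there m)) ¬aS))
    where
    ¬aS = ¬Any⇒All¬ xs ¬meets
    old-walk : ∀ {ys p q} → All (_∉ a ∷ S) ys → IsWalk (Adj (_ ∷ _)) ys p q → IsWalk (Adj _) ys p q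
    old-walk av = walk-avoiding-endpoint (IsEdge-start ab) (λ m → All.lookup av m (here refl))
  ... | yes meets with walk-firstHit (_∈? (a ∷ S)) w meets
  ...   | inj₁ u∈aS = ¬Z (link u u [ u ] u∈ u∈aS single (All.lookup avZ (walk-head w) ∷ []))
  ...   | inj₂ (ps , q , h , wp , ¬aS , rqh , h∈aS , ps⊆ , h∈) with Adj-∷⁻ rqh
  ...     | inj₁ r′ = ¬Z (link u h (ps ++ [ h ]) u∈ h∈aS (walk-snoc old-wp r′)
                          (All-resp-⊇ (++-⊆ₘ ps⊆ (λ { (here refl) → h∈ })) avZ))
    where old-wp = walk-avoiding-endpoint (IsEdge-start ab) (λ m → All.lookup ¬aS m (here refl)) wp
  ...     | inj₂ qh with IsEdge-other-start ab qh (λ q≡a → All.lookup ¬aS (walk-last wp) (here q≡a))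
  ...       | refl = ¬S (link-join (link u q ps u∈ (here refl) old-wp (All.map (λ z∉ m → z∉ (there m)) ¬aS)) fromB)
    where old-wp = walk-avoiding-endpoint (IsEdge-start ab) (λ m → All.lookup ¬aS m (here refl)) wp

  -- Cut the A–(a ∷ S) walks at their first vertex in a ∷ S and the (b ∷ S)–B walks after
  -- their last vertex in b ∷ S. As |b ∷ S| ≤ k, every vertex of b ∷ S begins a cut second
  -- walk, so each cut first walk has a partner (the one ending in a is joined through the
  -- edge a b to the one beginning in b). Pieces of different pairs cannot meet, as E would
  -- then contain an A–B walk avoiding S.
  module Recombine {x y : V} {E : List (Edge n)} {A B S : List V} {a b : V} {k : ℕ}
    (ab : IsEdge x y a b) (a≢b : a ≢ b) (toA : Link E A [ a ] S) (fromB : Link E [ b ] B S)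
    (¬S : ¬ Link E A B S) (|S|<k : length S < k)
    (Q : Linkage E A (a ∷ S) k) (R : Linkage E (b ∷ S) B k) where

    private
      module Q = Linkage Q
      module R = Linkage R

    b∉S : b ∉ S
    b∉S = start-avoids fromB

    record Head (i : Fin k) : Set where
      field
        vertices : List V
        start hit : V
        start∈ : start ∈ A
        hit∈ : hit ∈ a ∷ S
        walk : IsWalk (Adj E) vertices start hit
        ⊆route : vertices ⊆ₘ Q.route i
        before : ∀ {z} → z ∈ vertices → z ≡ hit ⊎ Link E A [ z ] (a ∷ S)

    record Tail (j : Fin k) : Set where
      field
        vertices : List V
        hit end : V
        end∈ : end ∈ B
        hit∈ : hit ∈ b ∷ S
        walk : IsWalk (Adj E) vertices hit end
        ⊆route : vertices ⊆ₘ R.route j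
        after : ∀ {z} → z ∈ vertices → z ≡ hit ⊎ Link E [ z ] B (b ∷ S)

    abstract
      head : ∀ i → Head i
      head i with Q.connects i
      ... | u , _ , u∈ , v∈ , w with walk-untilFirst (_∈? (a ∷ S)) w v∈
      ... | qs , h , wq , h∈ , qs⊆ , before = record
        { vertices = qs ; start = u ; hit = h ; start∈ = u∈ ; hit∈ = h∈ ; walk = wq ; ⊆route = qs⊆
        ; before = λ m → map₂ (λ (ys , wy , ay) → link u _ ys u∈ (here refl) wy ay) (before m) }

      tail : ∀ j → Tail j
      tail j with R.connects j
      ... | _ , v , u∈ , v∈ , w with walk-untilFirst (_∈? (b ∷ S)) (walk-reverse Adj-sym w) u∈
      ... | qs , g , wq , g∈ , qs⊆ , before = record
        { vertices = reverse qs ; hit = g ; end = v ; end∈ = v∈ ; hit∈ = g∈ ; walk = walk-reverse Adj-sym wq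
        ; ⊆route = λ m → reverse⁻ (qs⊆ (reverse⁻ m))
        ; after = λ m → map₂ (λ (ys , wy , ay) → link-reverse (link v _ ys v∈ (here refl) wy ay))
                                     (before (reverse⁻ m)) }

    headHit : Fin k → V
    headHit i = Head.hit (head i)

    tailHit : Fin k → V
    tailHit j = Tail.hit (tail j)

    headHit-injective : ∀ i i′ → headHit i ≡ headHit i′ → i ≡ i′
    headHit-injective i i′ eq with i ≟ᶠ i′
    ... | yes p = p
    ... | no i≢i′ = ⊥-elim (Q.disjoint i i′ i≢i′ (on-route i) (subst (_∈ Q.route i′) (sym eq) (on-route i′)))
      where
      on-route : ∀ i → headHit i ∈ Q.route i
      on-route i = Head.⊆route (head i) (walk-last (Head.walk (head i)))

    tailHit-injective : ∀ j j′ → tailHit j ≡ tailHit j′ → j ≡ j′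
    tailHit-injective j j′ eq with j ≟ᶠ j′
    ... | yes p = p
    ... | no j≢j′ = ⊥-elim (R.disjoint j j′ j≢j′ (on-route j) (subst (_∈ R.route j′) (sym eq) (on-route j′)))
      where
      on-route : ∀ j → tailHit j ∈ R.route j
      on-route j = Tail.⊆route (tail j) (walk-head (Tail.walk (tail j)))

    tailHit-covers : ∀ {z} → z ∈ b ∷ S → Σ (Fin k) λ j → tailHit j ≡ z
    tailHit-covers = injection-into-list-covers (b ∷ S) tailHit (λ j → Tail.hit∈ (tail j)) tailHit-injective |S|<k

    headHit∈S : ∀ i → headHit i ≢ a → headHit i ∈ S
    headHit∈S i h≢a with Head.hit∈ (head i)
    ... | here h≡a = ⊥-elim (h≢a h≡a)
    ... | there h∈S = h∈S

    record Partner (i : Fin k) : Set where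
      field
        mate : Fin k
        meets : (headHit i ≡ a × tailHit mate ≡ b) ⊎ (headHit i ≢ a × tailHit mate ≡ headHit i)

    abstract
      partner : ∀ i → Partner i
      partner i with headHit i ≟ᶠ a
      ... | yes h≡a = let (j , g≡b) = tailHit-covers (here refl) in record { mate = j ; meets = inj₁ (h≡a , g≡b) }
      ... | no h≢a = let (j , g≡h) = tailHit-covers (there (headHit∈S i h≢a)) in
                     record { mate = j ; meets = inj₂ (h≢a , g≡h) }

    σ : Fin k → Fin k
    σ i = Partner.mate (partner i)

    σ-injective : ∀ i i′ → σ i ≡ σ i′ → i ≡ i′
    σ-injective i i′ eq with Partner.meets (partner i) | Partner.meets (partner i′) | cong tailHit eq
    ... | inj₁ (h≡a , g≡b) | inj₁ (h′≡a , _) | _ = headHit-injective i i′ (trans h≡a (sym h′≡a))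
    ... | inj₁ (_ , g≡b) | inj₂ (h′≢a , g′≡h′) | g≡g′ =
      ⊥-elim (b∉S (subst (_∈ S) (sym (trans (sym g≡b) (trans g≡g′ g′≡h′))) (headHit∈S i′ h′≢a)))
    ... | inj₂ (h≢a , g≡h) | inj₁ (_ , g′≡b) | g≡g′ =
      ⊥-elim (b∉S (subst (_∈ S) (trans (sym g≡h) (trans g≡g′ g′≡b)) (headHit∈S i h≢a)))
    ... | inj₂ (_ , g≡h) | inj₂ (_ , g′≡h′) | g≡g′ =
      headHit-injective i i′ (trans (sym g≡h) (trans g≡g′ g′≡h′))

    head-tail-disjoint : ∀ i i′ → i ≢ i′ → ∀ {z} →
      z ∈ Head.vertices (head i) → z ∈ Tail.vertices (tail (σ i′)) → ⊥
    head-tail-disjoint i i′ i≢i′ z∈h z∈t with Head.before (head i) z∈h | Tail.after (tail (σ i′)) z∈t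
    ... | inj₂ toZ | inj₂ fromZ = ¬S (link-join (link-avoids-⊆ there toZ) (link-avoids-⊆ there fromZ))
    ... | inj₁ z≡h | inj₂ fromZ with Head.hit∈ (head i)
    ...   | here h≡a = ¬S (link-join toA (subst (λ c → Link E [ c ] B S) (trans z≡h h≡a) (link-avoids-⊆ there fromZ)))
    ...   | there h∈S = start-avoids fromZ (there (subst (_∈ S) (sym z≡h) h∈S))
    head-tail-disjoint i i′ i≢i′ z∈h z∈t | inj₂ toZ | inj₁ z≡g with Tail.hit∈ (tail (σ i′))
    ...   | here g≡b = ¬S (link-join (subst (λ c → Link E A [ c ] S) (trans z≡g g≡b) (link-avoids-⊆ there toZ)) fromB)
    ...   | there g∈S = end-avoids toZ (there (subst (_∈ S) (sym z≡g) g∈S))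
    head-tail-disjoint i i′ i≢i′ z∈h z∈t | inj₁ z≡h | inj₁ z≡g with Partner.meets (partner i′)
    ...   | inj₁ (_ , g≡b) with Head.hit∈ (head i)
    ...     | here h≡a = a≢b (trans (sym h≡a) (trans (sym z≡h) (trans z≡g g≡b)))
    ...     | there h∈S = b∉S (subst (_∈ S) (trans (sym z≡h) (trans z≡g g≡b)) h∈S)
    head-tail-disjoint i i′ i≢i′ z∈h z∈t | inj₁ z≡h | inj₁ z≡g | inj₂ (_ , g≡h′) =
      i≢i′ (headHit-injective i i′ (trans (sym z≡h) (trans z≡g g≡h′)))

    joined : ∀ i → Σ (List V) λ ws →
      IsWalk (Adj ((x , y) ∷ E)) ws (Head.start (head i)) (Tail.end (tail (σ i))) ×
      ws ⊆ₘ Head.vertices (head i) ++ Tail.vertices (tail (σ i))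
    joined i with Partner.meets (partner i)
    ... | inj₁ (h≡a , g≡b) =
      _ , walk-++ (walk-map Adj-∷ (Head.walk (head i)))
                  (walk-∷ (IsEdge⇒Adj (subst₂ (IsEdge x y) (sym h≡a) (sym g≡b) ab))
                          (walk-map Adj-∷ (Tail.walk (tail (σ i))))) ,
      (λ m → m)
    ... | inj₂ (_ , g≡h) =
      walk-join (walk-map Adj-∷ (Head.walk (head i)))
                (subst (λ c → IsWalk (Adj ((x , y) ∷ E)) (Tail.vertices (tail (σ i))) c (Tail.end (tail (σ i)))) g≡h
                       (walk-map Adj-∷ (Tail.walk (tail (σ i)))))

    linkage : Linkage ((x , y) ∷ E) A B k
    linkage = record
      { route = λ i → proj₁ (joined i)
      ; connects = λ i → _ , _ , Head.start∈ (head i) , Tail.end∈ (tail (σ i)) , proj₁ (proj₂ (joined i))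
      ; disjoint = disjoint }
      where
      disjoint : ∀ i i′ → i ≢ i′ → ∀ {z} → z ∈ proj₁ (joined i) → z ∈ proj₁ (joined i′) → ⊥
      disjoint i i′ i≢i′ z∈ z∈′ with ∈-++⁻ (Head.vertices (head i)) (proj₂ (proj₂ (joined i)) z∈)
                                  | ∈-++⁻ (Head.vertices (head i′)) (proj₂ (proj₂ (joined i′)) z∈′)
      ... | inj₁ p | inj₁ q = Q.disjoint i i′ i≢i′ (Head.⊆route (head i) p) (Head.⊆route (head i′) q)
      ... | inj₂ p | inj₂ q = R.disjoint (σ i) (σ i′) (λ e → i≢i′ (σ-injective i i′ e))
                                (Tail.⊆route (tail (σ i)) p) (Tail.⊆route (tail (σ i′)) q)
      ... | inj₁ p | inj₂ q = head-tail-disjoint i i′ i≢i′ p q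
      ... | inj₂ p | inj₁ q = head-tail-disjoint i′ i (λ e → i≢i′ (sym e)) q p

  Linkage-∷ : ∀ {e E A B k} → Linkage E A B k → Linkage (e ∷ E) A B k
  Linkage-∷ L = record
    { route = Linkage.route L
    ; connects = λ i → let (u , v , u∈ , v∈ , w) = Linkage.connects L i in u , v , u∈ , v∈ , walk-map Adj-∷ w
    ; disjoint = Linkage.disjoint L }

  private
    InBoth? : (A B : List V) → ∀ v → Dec (v ∈ A × v ∈ B)
    InBoth? A B v = (v ∈? A) ×-dec (v ∈? B)

  -- Without edges, A–B links are the single vertices of A ∩ B.
  menger-[] : ∀ (A B : List V) (k : ℕ) → Linkage [] A B k ⊎ Separator [] A B k
  menger-[] A B k with k ≤? length (filter (InBoth? A B) (allFin n))
  ... | yes k≤ = inj₁ record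
    { route = λ i → [ lookup common (inject≤ i k≤) ]
    ; connects = λ i → let (_ , u∈A , u∈B) = ∈-filter⁻ (InBoth? A B) {xs = allFin n} (∈-lookup (inject≤ i k≤))
                       in _ , _ , u∈A , u∈B , single
    ; disjoint = λ { i j i≢j (here refl) (here eq) →
        i≢j (inject≤-injective k≤ k≤ i j (Unique-lookup-injective (filter⁺ (InBoth? A B) (allFin⁺ n)) _ _ eq)) } }
    where
    common = filter (InBoth? A B) (allFin n)
  ... | no k≰ = inj₂ (filter (InBoth? A B) (allFin n) , ≰⇒> k≰ , λ (link u v xs u∈ v∈ w av) → trivial w u∈ v∈ av)
    where
    trivial : ∀ {xs u v} → IsWalk (Adj []) xs u v → u ∈ A → v ∈ B → All (_∉ filter (InBoth? A B) (allFin n)) xs → ⊥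
    trivial single u∈A u∈B (u∉ ∷ []) = u∉ (∈-filter⁺ (InBoth? A B) (∈-allFin _) (u∈A , u∈B))
    trivial (step (inj₁ ()) _)
    trivial (step (inj₂ ()) _)

  menger : ∀ (E : List (Edge n)) (A B : List V) (k : ℕ) → Linkage E A B k ⊎ Separator E A B k
  menger [] A B k = menger-[] A B k
  menger ((x , y) ∷ E) A B k with menger E A B k
  ... | inj₁ L = inj₁ (Linkage-∷ L)
  ... | inj₂ (S , |S|<k , ¬S) with link? ((x , y) ∷ E) A B S
  ...   | no ¬S′ = inj₂ (S , |S|<k , ¬S′)
  ...   | yes S-link with link-through-new-edge S-link ¬S
  ...     | a , b , ab , a≢b , toA , fromB with menger E A (a ∷ S) k | menger E (b ∷ S) B k
  ...       | inj₂ (Z , |Z|<k , ¬Z) | _ =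
                inj₂ (Z , |Z|<k , separator-survives-new-edge ab fromB ¬S ¬Z)
  ...       | inj₁ _ | inj₂ (Z , |Z|<k , ¬Z) =
                inj₂ (Z , |Z|<k , λ L → separator-survives-new-edge (IsEdge-sym ab) (link-reverse toA)
                                          (λ L′ → ¬S (link-reverse L′)) (λ L′ → ¬Z (link-reverse L′)) (link-reverse L))
  ...       | inj₁ Q | inj₁ R = inj₁ (Recombine.linkage ab a≢b toA fromB ¬S |S|<k Q R)

-- Internally disjoint paths between two vertices

module _ {n : ℕ} where

  private
    V = Fin n

  Loopless : List (Edge n) → Set
  Loopless H = All (λ e → proj₁ e ≢ proj₂ e) H

  Adj⇒≢ : ∀ {H : List (Edge n)} {s t} → Loopless H → Adj H s t → s ≢ t
  Adj⇒≢ loopless (inj₁ m) = All.lookup loopless m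
  Adj⇒≢ loopless (inj₂ m) = λ e → All.lookup loopless m (sym e)

  Avoids₂ : V → V → V → Set
  Avoids₂ a b z = z ≢ a × z ≢ b

  avoids₂? : ∀ a b z → Dec (Avoids₂ a b z)
  avoids₂? a b z = ¬? (z ≟ᶠ a) ×-dec ¬? (z ≟ᶠ b)

  _∖⟨_,_⟩ : List (Edge n) → V → V → List (Edge n)
  H ∖⟨ a , b ⟩ = filter (λ e → avoids₂? a b (proj₁ e) ×-dec avoids₂? a b (proj₂ e)) H

  neighbours : List (Edge n) → V → V → List V
  neighbours H a b = filter (λ v → Adj? H a v ×-dec ¬? (v ≟ᶠ b)) (allFin n)

  neighbour-adj : ∀ {H a b v} → v ∈ neighbours H a b → Adj H a v
  neighbour-adj {H} {a} {b} m = proj₁ (proj₂ (∈-filter⁻ (λ v → Adj? H a v ×-dec ¬? (v ≟ᶠ b)) {xs = allFin n} m))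

  neighbour-≢ : ∀ {H a b v} → v ∈ neighbours H a b → v ≢ b
  neighbour-≢ {H} {a} {b} m = proj₂ (proj₂ (∈-filter⁻ (λ v → Adj? H a v ×-dec ¬? (v ≟ᶠ b)) {xs = allFin n} m))

  neighbour⁺ : ∀ {H a b v} → Adj H a v → v ≢ b → v ∈ neighbours H a b
  neighbour⁺ {H} {a} {b} adj v≢b = ∈-filter⁺ (λ v → Adj? H a v ×-dec ¬? (v ≟ᶠ b)) (∈-allFin _) (adj , v≢b)

  ∖-Adj⁺ : ∀ {H a b s t} → Avoids₂ a b s → Avoids₂ a b t → Adj H s t → Adj (H ∖⟨ a , b ⟩) s t
  ∖-Adj⁺ s-off t-off (inj₁ m) = inj₁ (∈-filter⁺ _ m (s-off , t-off))
  ∖-Adj⁺ s-off t-off (inj₂ m) = inj₂ (∈-filter⁺ _ m (t-off , s-off))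

  ∖-Adj⁻ : ∀ {H a b s t} → Adj (H ∖⟨ a , b ⟩) s t → Adj H s t × Avoids₂ a b t
  ∖-Adj⁻ {H} (inj₁ m) = let (e∈ , _ , t-off) = ∈-filter⁻ _ {xs = H} m in inj₁ e∈ , t-off
  ∖-Adj⁻ {H} (inj₂ m) = let (e∈ , t-off , _) = ∈-filter⁻ _ {xs = H} m in inj₂ e∈ , t-off

  ∖-walk-avoids : ∀ {H a b ys u v} → IsWalk (Adj (H ∖⟨ a , b ⟩)) ys u v → Avoids₂ a b u → All (Avoids₂ a b) ys
  ∖-walk-avoids single u-off = u-off ∷ []
  ∖-walk-avoids {H} (step r w) u-off = u-off ∷ ∖-walk-avoids {H} w (proj₂ (∖-Adj⁻ {H} r))

  NotStep : V → V → V → V → Set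
  NotStep a b u x = ¬ (u ≡ a × x ≡ b) × ¬ (u ≡ b × x ≡ a)

  NotStep-sym : ∀ {a b u x} → NotStep a b u x → NotStep a b x u
  NotStep-sym (¬ab , ¬ba) = (λ (u≡a , x≡b) → ¬ba (x≡b , u≡a)) , (λ (u≡b , x≡a) → ¬ab (x≡a , u≡b))

  Allowed : V → V → List V → V → Set
  Allowed a b Z z = z ≡ a ⊎ z ≡ b ⊎ z ∉ Z

  Allowed⇒∉ : ∀ {a b Z z} → Allowed a b Z z → Avoids₂ a b z → z ∉ Z
  Allowed⇒∉ (inj₁ e) (z≢a , _) = ⊥-elim (z≢a e)
  Allowed⇒∉ (inj₂ (inj₁ e)) (_ , z≢b) = ⊥-elim (z≢b e)
  Allowed⇒∉ (inj₂ (inj₂ z∉)) _ = z∉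

  AvoidingWalk : List (Edge n) → V → V → List V → Set
  AvoidingWalk H a b Z = Σ (List V) λ xs → IsWalk (Adj H) xs a b × All (Allowed a b Z) xs × Linked (NotStep a b) xs

  module _ {H : List (Edge n)} (loopless : Loopless H) {a b : V} (a≢b : a ≢ b) {Z : List V} where

    private
      Link* = Link (H ∖⟨ a , b ⟩) (neighbours H a b) (neighbours H b a) Z

    -- Reading the walk from its end: the last stretch through vertices other than a and b
    -- runs from a neighbour of a to a neighbour of b in H ∖ {a, b}.
    avoidingWalk⇒link-from : ∀ {xs s} → IsWalk (Adj H) xs s b → All (Allowed a b Z) xs → Linked (NotStep a b) xs →
      (s ≡ a → Link*) × (Avoids₂ a b s → Link (H ∖⟨ a , b ⟩) [ s ] (neighbours H b a) Z ⊎ Link*)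
    avoidingWalk⇒link-from single _ _ = (λ e → ⊥-elim (a≢b (sym e))) , (λ (_ , b≢b) → ⊥-elim (b≢b refl))
    avoidingWalk⇒link-from {s = s} (step {x = x} r w) (s-ok ∷ ok) ((¬ab , ¬ba) ∷ steps) with avoidingWalk⇒link-from w ok steps
    ... | from-a , from-off = from-s≡a , from-s-off
      where
      from-s≡a : s ≡ a → Link*
      from-s≡a refl with from-off ((λ x≡a → Adj⇒≢ loopless r (sym x≡a)) , (λ x≡b → ¬ab (refl , x≡b)))
      ... | inj₁ (link _ v ys (here refl) v∈ w′ av) = link x v ys (neighbour⁺ r (λ x≡b → ¬ab (refl , x≡b))) v∈ w′ av
      ... | inj₂ L = L
      from-s-off : Avoids₂ a b s → _
      from-s-off s-off@(s≢a , _) with Allowed⇒∉ s-ok s-off | x ≟ᶠ b | x ≟ᶠ a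
      ... | s∉ | yes refl | _ = inj₁ (link s s [ s ] (here refl) (neighbour⁺ (Adj-sym r) s≢a) single (s∉ ∷ []))
      ... | s∉ | no _ | yes refl = inj₂ (from-a refl)
      ... | s∉ | no x≢b | no x≢a with from-off (x≢a , x≢b)
      ...   | inj₁ (link _ v ys (here refl) v∈ w′ av) =
              inj₁ (link s v (s ∷ ys) (here refl) v∈ (walk-∷ (∖-Adj⁺ s-off (x≢a , x≢b) r) w′) (s∉ ∷ av))
      ...   | inj₂ L = inj₂ L

    avoidingWalk⇒link : AvoidingWalk H a b Z → Link*
    avoidingWalk⇒link (xs , w , ok , steps) = proj₁ (avoidingWalk⇒link-from w ok steps) refl

  HasDisjointDetours : List (Edge n) → V → V → ℕ → Set
  HasDisjointDetours H a b m =
    Σ (Fin m → List V) λ ps → (∀ i → IsPath (Adj H) (ps i) a b) ×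
      (∀ i j → i ≢ j → ps i ≢ ps j × InternallyDisjoint a b (ps i) (ps j)) ×
      (∀ i → Σ V λ z → z ∈ ps i × Avoids₂ a b z)

  ∈-bracketed⁻ : ∀ {a b z : V} ys → z ∈ a ∷ ys ++ [ b ] → z ≡ a ⊎ z ≡ b ⊎ z ∈ ys
  ∈-bracketed⁻ ys (here e) = inj₁ e
  ∈-bracketed⁻ ys (there m) with ∈-++⁻ ys m
  ... | inj₁ z∈ = inj₂ (inj₂ z∈)
  ... | inj₂ (here e) = inj₂ (inj₁ e)

  Unique-snoc : ∀ {ys : List V} {b} → Unique ys → All (_≢ b) ys → Unique (ys ++ [ b ])
  Unique-snoc {[]} _ _ = [] ∷ []
  Unique-snoc {y ∷ ys} (y∉ ∷ u) (y≢b ∷ ≢b) = All-++⁺ y∉ (y≢b ∷ []) ∷ Unique-snoc u ≢b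

  module _ {H : List (Edge n)} (loopless : Loopless H) {a b : V} (a≢b : a ≢ b) where

    record Bracketed (ps : List V) : Set where
      field
        interior : List V
        isPath : IsPath (Adj H) (a ∷ interior ++ [ b ]) a b
        first : V
        first∈ : first ∈ interior
        first-off : Avoids₂ a b first
        ⊆ps : interior ⊆ₘ ps

    bracketed-path : ∀ {ps u v} → u ∈ neighbours H a b → v ∈ neighbours H b a → IsWalk (Adj (H ∖⟨ a , b ⟩)) ps u v →
      Bracketed ps
    bracketed-path {u = u} u∈ v∈ w with walk⇒path w
    ... | ys , wy , uy , ys⊆ , _ = record
      { interior = ys
      ; isPath = walk-∷ (neighbour-adj u∈)
                        (walk-snoc (walk-map (λ r → proj₁ (∖-Adj⁻ {H} r)) wy) (Adj-sym (neighbour-adj v∈))) ,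
                 All-++⁺ (All.map (λ (z≢a , _) e → z≢a (sym e)) off) (a≢b ∷ []) ∷ Unique-snoc uy (All.map proj₂ off)
      ; first = u ; first∈ = walk-head wy ; first-off = u-off ; ⊆ps = ys⊆ }
      where
      u-off : Avoids₂ a b u
      u-off = (λ u≡a → Adj⇒≢ loopless (neighbour-adj u∈) (sym u≡a)) , neighbour-≢ u∈
      off = ∖-walk-avoids {H} wy u-off

    disjointDetours : ∀ m → (∀ Z → length Z < m → AvoidingWalk H a b Z) → HasDisjointDetours H a b m
    disjointDetours m avoiding with menger (H ∖⟨ a , b ⟩) (neighbours H a b) (neighbours H b a) m
    ... | inj₂ (Z , |Z|<m , ¬link) = ⊥-elim (¬link (avoidingWalk⇒link loopless a≢b (avoiding Z |Z|<m)))
    ... | inj₁ L = path , (λ i → D.isPath i) , pairwise , λ i → D.first i , there (∈-++⁺ˡ (D.first∈ i)) , D.first-off i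
      where
      open Linkage L
      detour : ∀ i → Bracketed (route i)
      detour i = let (_ , _ , u∈ , v∈ , w) = connects i in bracketed-path u∈ v∈ w
      module D i = Bracketed (detour i)
      path : Fin m → List V
      path i = a ∷ D.interior i ++ [ b ]
      interiors-disjoint : ∀ i j → i ≢ j → ∀ {z} → z ∈ D.interior i → z ∈ D.interior j → _
      interiors-disjoint i j i≢j zi zj = disjoint i j i≢j (D.⊆ps i zi) (D.⊆ps j zj)
      pairwise : ∀ i j → i ≢ j → path i ≢ path j × InternallyDisjoint a b (path i) (path j)
      pairwise i j i≢j = distinct , internally-disjoint
        where
        internally-disjoint : InternallyDisjoint a b (path i) (path j)
        internally-disjoint z zi zj with ∈-bracketed⁻ (D.interior i) zi | ∈-bracketed⁻ (D.interior j) zj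
        ... | inj₁ e | _ = inj₁ e
        ... | inj₂ (inj₁ e) | _ = inj₂ e
        ... | inj₂ (inj₂ _) | inj₁ e = inj₁ e
        ... | inj₂ (inj₂ _) | inj₂ (inj₁ e) = inj₂ e
        ... | inj₂ (inj₂ zi′) | inj₂ (inj₂ zj′) = ⊥-elim (interiors-disjoint i j i≢j zi′ zj′)
        distinct : path i ≢ path j
        distinct eq with ∈-bracketed⁻ (D.interior j) (subst (D.first i ∈_) eq (there (∈-++⁺ˡ (D.first∈ i))))
        ... | inj₁ e = proj₁ (D.first-off i) e
        ... | inj₂ (inj₁ e) = proj₂ (D.first-off i) e
        ... | inj₂ (inj₂ u∈′) = interiors-disjoint i j i≢j (D.first∈ i) u∈′

    disjointPaths : ∀ m → (∀ Z → length Z < m → AvoidingWalk H a b Z) → HasDisjointPaths H a b m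
    disjointPaths m avoiding = let (ps , isPath , pairwise , _) = disjointDetours m avoiding in ps , isPath , pairwise

    -- The edge a b is one further path, internally disjoint from all detours.
    disjointPaths-adjacent : Adj H a b → ∀ m → (∀ Z → suc (length Z) < m → AvoidingWalk H a b Z) →
      HasDisjointPaths H a b m
    disjointPaths-adjacent adj zero _ = (λ ()) , (λ ()) , (λ ())
    disjointPaths-adjacent adj (suc m) avoiding with disjointDetours m (λ Z |Z|<m → avoiding Z (s≤s |Z|<m))
    ... | ps , isPath , pairwise , interior = qs , isPath′ , pairwise′
      where
      qs : Fin (suc m) → List V
      qs zero = a ∷ b ∷ []
      qs (suc i) = ps i
      isPath′ : ∀ i → IsPath (Adj H) (qs i) a b
      isPath′ zero = step adj single , (a≢b ∷ []) ∷ [] ∷ []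
      isPath′ (suc i) = isPath i
      ends : ∀ {z} → z ∈ a ∷ b ∷ [] → z ≡ a ⊎ z ≡ b
      ends (here e) = inj₁ e
      ends (there (here e)) = inj₂ e
      edge≢detour : ∀ i → a ∷ b ∷ [] ≢ ps i
      edge≢detour i eq with interior i
      ... | z , z∈ , (z≢a , z≢b) with ends (subst (z ∈_) (sym eq) z∈)
      ...   | inj₁ e = z≢a e
      ...   | inj₂ e = z≢b e
      pairwise′ : ∀ i j → i ≢ j → qs i ≢ qs j × InternallyDisjoint a b (qs i) (qs j)
      pairwise′ zero zero i≢j = ⊥-elim (i≢j refl)
      pairwise′ zero (suc j) _ = edge≢detour j , λ z z∈ _ → ends z∈
      pairwise′ (suc i) zero _ = (λ e → edge≢detour i (sym e)) , λ z _ z∈ → ends z∈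
      pairwise′ (suc i) (suc j) i≢j = pairwise i j (λ e → i≢j (cong suc e))

-- Weight buckets

module _ (d : ℕ) .{{_ : NonZero d}} where

  open ≤-Reasoning

  -- Both weights lie in [(1+1/d)^i, (1+1/d)^(i+1)), so their ratio is below 1 + 1/d.
  sameBucket-ratio : ∀ W w′ j → InBucket 1 d W j → InBucket 1 d w′ j → d * w′ ≤ (d + 1) * W
  sameBucket-ratio W w′ zero _ refl = ≤-trans (≤-reflexive (*-zeroʳ d)) z≤n
  sameBucket-ratio W w′ (suc i) (lower , _) (_ , upper) = <⇒≤ (*-cancelʳ-< (d ^ i) (d * w′) ((d + 1) * W) (begin-strict
    d * w′ * d ^ i          ≡⟨ reassoc d w′ (d ^ i) ⟩
    w′ * (d * d ^ i)        <⟨ upper ⟩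
    (d + 1) * (d + 1) ^ i   ≤⟨ *-monoʳ-≤ (d + 1) lower ⟩
    (d + 1) * (W * d ^ i)   ≡⟨ sym (*-assoc (d + 1) W (d ^ i)) ⟩
    (d + 1) * W * d ^ i     ∎))
    where
    reassoc : ∀ a b c → a * b * c ≡ b * (a * c)
    reassoc = solve-∀

  -- Bernoulli's inequality (1 + 1/d)^m ≥ 1 + m/d, cleared of denominators.
  bernoulli : ∀ m → d ^ suc m + m * d ^ m ≤ d * (d + 1) ^ m
  bernoulli zero = ≤-reflexive (+-identityʳ (d * 1))
  bernoulli (suc m) = begin
    d * (d * X) + suc m * (d * X)          ≤⟨ m≤m+n _ (m * X) ⟩
    d * (d * X) + suc m * (d * X) + m * X  ≡⟨ regroup d m X ⟩
    (d + 1) * (d * X + m * X)              ≤⟨ *-monoʳ-≤ (d + 1) (bernoulli m) ⟩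
    (d + 1) * (d * (d + 1) ^ m)            ≡⟨ swap (d + 1) d ((d + 1) ^ m) ⟩
    d * ((d + 1) * (d + 1) ^ m)            ∎
    where
    X = d ^ m
    regroup : ∀ d m X → d * (d * X) + suc m * (d * X) + m * X ≡ (d + 1) * (d * X + m * X)
    regroup = solve-∀
    swap : ∀ a b c → a * (b * c) ≡ b * (a * c)
    swap = solve-∀

  -- Hence W lies below the bucket with index W·d.
  below-bucket : ∀ W → W * d ^ (W * d) < (d + 1) ^ (W * d)
  below-bucket W = *-cancelˡ-≤ d (begin
    d * suc (W * X)          ≡⟨ expand d W X ⟩
    d * (W * X) + d * 1      ≤⟨ +-monoʳ-≤ (d * (W * X)) (*-monoʳ-≤ d (m^n>0 d (W * d))) ⟩
    d * (W * X) + d * X      ≡⟨ regroup d W X ⟩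
    d * X + (W * d) * X      ≤⟨ bernoulli (W * d) ⟩
    d * (d + 1) ^ (W * d)    ∎)
    where
    X = d ^ (W * d)
    expand : ∀ d W X → d * suc (W * X) ≡ d * (W * X) + d * 1
    expand = solve-∀
    regroup : ∀ d W X → d * (W * X) + d * X ≡ d * X + (W * d) * X
    regroup = solve-∀

  inSomeBucket : ∀ W → Σ ℕ λ j → InBucket 1 d W j
  inSomeBucket zero = 0 , refl
  inSomeBucket W@(suc _) = search (W * d) 0 (≤-trans (s≤s z≤n) (≤-reflexive (sym (*-identityʳ W))))
    (subst (λ q → W * d ^ q < (d + 1) ^ q) (sym (+-identityˡ (W * d))) (below-bucket W))
    where
    search : ∀ fuel i → (d + 1) ^ i ≤ W * d ^ i → W * d ^ (i + fuel) < (d + 1) ^ (i + fuel) →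
             Σ ℕ λ j → InBucket 1 d W j
    search fuel i lower bound with W * d ^ suc i <? (d + 1) ^ suc i
    ... | yes upper = suc i , lower , upper
    search zero i lower bound | no _ = ⊥-elim (<⇒≱ (subst (λ q → W * d ^ q < (d + 1) ^ q) (+-identityʳ i) bound) lower)
    search (suc fuel) i lower bound | no ¬upper =
      search fuel (suc i) (≮⇒≥ ¬upper) (subst (λ q → W * d ^ q < (d + 1) ^ q) (+-suc i fuel) bound)

  bucket-walk-weight : ∀ {n} (w : Fin n → Fin n → ℕ) W j (L : List (Edge n)) → InBucket 1 d W j →
    All (λ e → InBucket 1 d (w (proj₁ e) (proj₂ e)) j) L → length L ≤ d → weight w L ≤ (d + 1) * W
  bucket-walk-weight w W j L W∈ L∈ |L|≤d = *-cancelˡ-≤ d (begin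
    d * weight w L            ≤⟨ scaled L L∈ ⟩
    length L * ((d + 1) * W)  ≤⟨ *-monoˡ-≤ ((d + 1) * W) |L|≤d ⟩
    d * ((d + 1) * W)         ∎)
    where
    scaled : ∀ L → All (λ e → InBucket 1 d (w (proj₁ e) (proj₂ e)) j) L → d * weight w L ≤ length L * ((d + 1) * W)
    scaled [] [] = ≤-reflexive (*-zeroʳ d)
    scaled ((x , y) ∷ L) (e∈ ∷ L∈) = begin
      d * (w x y + weight w L)       ≡⟨ *-distribˡ-+ d (w x y) _ ⟩
      d * w x y + d * weight w L     ≤⟨ +-mono-≤ (sameBucket-ratio W (w x y) j W∈ e∈) (scaled L L∈) ⟩
      (d + 1) * W + length L * ((d + 1) * W) ∎

-- The greedy spanner and its detours

inBucket? : ∀ num den W j → Dec (InBucket num den W j)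
inBucket? num den W zero = W ≟ 0
inBucket? num den W (suc i) = ((den + num) ^ i ≤? W * den ^ i) ×-dec (W * den ^ suc i <? (den + num) ^ suc i)

module _ {a p} {A : Set a} {P : A → Set p} (P? : ∀ x → Dec (P x)) where

  length-filter-two : ∀ {xs u v} → u ∈ xs → v ∈ xs → u ≢ v → ¬ P u → ¬ P v → 2 + length (filter P? xs) ≤ length xs
  length-filter-two {x ∷ xs} (here refl) (here refl) u≢v _ _ = ⊥-elim (u≢v refl)
  length-filter-two {x ∷ xs} (here refl) (there v∈) _ ¬Pu ¬Pv with P? x
  ... | yes Px = ⊥-elim (¬Pu Px)
  ... | no _ = s≤s (filter-notAll P? xs (lose v∈ ¬Pv))
  length-filter-two {x ∷ xs} (there u∈) (here refl) _ ¬Pu ¬Pv with P? x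
  ... | yes Px = ⊥-elim (¬Pv Px)
  ... | no _ = s≤s (filter-notAll P? xs (lose u∈ ¬Pu))
  length-filter-two {x ∷ xs} (there u∈) (there v∈) u≢v ¬Pu ¬Pv with P? x
  ... | yes _ = s≤s (length-filter-two u∈ v∈ u≢v ¬Pu ¬Pv)
  ... | no _ = m≤n⇒m≤1+n (length-filter-two u∈ v∈ u≢v ¬Pu ¬Pv)

module _ {n : ℕ} (w : Fin n → Fin n → ℕ) (num den : ℕ) where

  adjBucket? : ∀ acc j a b → Dec (AdjBucket w num den acc j a b)
  adjBucket? acc j a b with Any.any? (λ e → inBucket? num den (w (proj₁ e) (proj₂ e)) j ×-dec
                                           (×-≡-dec _≟ᶠ_ _≟ᶠ_ e (a , b) ⊎-dec ×-≡-dec _≟ᶠ_ _≟ᶠ_ e (b , a))) acc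
  ... | yes found = let (e , e∈ , e-ok) = find found in yes (e , e∈ , e-ok)
  ... | no ¬found = no λ (e , e∈ , e-ok) → ¬found (lose e∈ e-ok)

  module _ {acc : List (Edge n)} {j : ℕ} where

    walk-edges : ∀ {xs u v} → IsWalk (AdjBucket w num den acc j) xs u v → List (Edge n)
    walk-edges single = []
    walk-edges (step (e , _) wk) = e ∷ walk-edges wk

    length-walk-edges : ∀ {xs u v} (wk : IsWalk (AdjBucket w num den acc j) xs u v) → suc (length (walk-edges wk)) ≡ length xs
    length-walk-edges single = refl
    length-walk-edges (step _ wk) = cong suc (length-walk-edges wk)

    walk-edges-in-bucket : ∀ {xs u v} (wk : IsWalk (AdjBucket w num den acc j) xs u v) →
      All (λ e → e ∈ acc × InBucket num den (w (proj₁ e) (proj₂ e)) j) (walk-edges wk)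
    walk-edges-in-bucket single = []
    walk-edges-in-bucket (step (e , e∈ , e-ok , _) wk) = (e∈ , e-ok) ∷ walk-edges-in-bucket wk

    walk-along-edges : ∀ {xs u v} (wk : IsWalk (AdjBucket w num den acc j) xs u v) → IsWalk (Adj (walk-edges wk)) xs u v
    walk-along-edges single = single
    walk-along-edges (step (e , _ , _ , inj₁ refl) wk) = step (inj₁ (here refl)) (walk-map Adj-∷ (walk-along-edges wk))
    walk-along-edges (step (e , _ , _ , inj₂ refl) wk) = step (inj₂ (here refl)) (walk-map Adj-∷ (walk-along-edges wk))

  module _ {t f : ℕ} where

    run-output : ∀ {acc σ out} → Run w t f num den acc σ out → Σ (List (Edge n)) λ ys → out ≡ acc ++ ys × ys ⊆ σ
    run-output done = [] , sym (++-identityʳ _) , []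
    run-output {acc} (add {e = e} _ r) with run-output r
    ... | ys , eq , ys⊆ = e ∷ ys , trans eq (++-assoc acc [ e ] ys) , refl ∷ ys⊆
    run-output (skip {e = e} _ r) with run-output r
    ... | ys , eq , ys⊆ = ys , eq , e ∷ʳ ys⊆

    run-keeps : ∀ {acc σ out} → Run w t f num den acc σ out → acc ⊆ₘ out
    run-keeps r m with run-output r
    ... | ys , refl , _ = ∈-++⁺ˡ m

    run-rejected : ∀ {acc σ out} → Run w t f num den acc σ out → ∀ {e} → e ∈ σ →
      e ∈ out ⊎ (Σ (List (Edge n)) λ acc′ → acc′ ⊆ₘ out × ¬ AddTest w t f num den acc′ e)
    run-rejected (add {acc = acc} _ r) (here refl) = inj₁ (run-keeps r (∈-++⁺ʳ acc (here refl)))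
    run-rejected (add _ r) (there m) = run-rejected r m
    run-rejected (skip {acc = acc} ¬test r) (here refl) = inj₂ (acc , run-keeps r , ¬test)
    run-rejected (skip _ r) (there m) = run-rejected r m

-- An edge x y rejected by the greedy test has k internally disjoint detours of at most 2t-1
-- edges in its bucket: collect them one at a time, each avoiding the interiors F of the
-- previous ones; as |F| ≤ (k-1)(2t-2) ≤ f, the failed test provides the next one.
module Detours {n : ℕ} (w : Fin n → Fin n → ℕ) {t f k : ℕ} (1≤t : 1 ≤ t) (budget : (k ∸ 1) * (2 * t ∸ 2) ≤ f)
  {acc : List (Edge n)} {x y : Fin n} (x≢y : x ≢ y) {j : ℕ} (xy∈ : InBucket 1 (2 * t ∸ 1) (w x y) j)
  (rejected : ¬ AddTest w t f 1 (2 * t ∸ 1) acc (x , y)) where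

  private
    d = 2 * t ∸ 1
    R = AdjBucket w 1 d acc j
    1≤2t : 1 ≤ 2 * t
    1≤2t = ≤-trans 1≤t (m≤m+n t _)
    instance
      d-nonZero : NonZero d
      d-nonZero = >-nonZero (∸-monoˡ-≤ 1 (*-monoʳ-≤ 2 1≤t))

  record Detour : Set where
    field
      vertices : List (Fin n)
      walk : IsWalk R vertices x y
      unique : Unique vertices
      short : length vertices ≤ 2 * t
  open Detour

  detour-avoiding : ∀ F → length F ≤ f → x ∉ F → y ∉ F → Σ Detour λ D → All (_∉ F) (vertices D)
  detour-avoiding F |F|≤f x∉F y∉F with boundedWalk? (adjBucket? w 1 d acc j) (λ z → ¬? (z ∈? F)) (2 * t) x y
  ... | yes (xs , wk , avoids , |xs|≤) with walk⇒path wk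
  ...   | ys , wy , uy , ys⊆ , |ys|≤ = record { vertices = ys ; walk = wy ; unique = uy ; short = ≤-trans |ys|≤ |xs|≤ } ,
                                      All-resp-⊇ ys⊆ avoids
  detour-avoiding F |F|≤f x∉F y∉F | no ¬short =
    ⊥-elim (rejected (j , xy∈ , F , |F|≤f , x∉F , y∉F , λ (xs , wk , avoids , hops) →
      ¬short (xs , wk , avoids , subst₂ _≤_ (m∸n+n≡m (walk-nonempty wk)) (m∸n+n≡m 1≤2t) (+-monoˡ-≤ 1 hops))))

  interior : Detour → List (Fin n)
  interior D = filter (λ z → ¬? (z ≟ᶠ x) ×-dec ¬? (z ≟ᶠ y)) (vertices D)

  length-interior : ∀ D → length (interior D) ≤ 2 * t ∸ 2
  length-interior D = m+n≤o⇒m≤o∸n (length (interior D)) (≤-trans (≤-reflexive (+-comm (length (interior D)) 2))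
    (≤-trans (length-filter-two _ (walk-head (walk D)) (walk-last (walk D)) x≢y (λ p → proj₁ p refl) (λ p → proj₂ p refl))
             (short D)))

  ∈-interior⁺ : ∀ D {z} → z ∈ vertices D → z ≢ x → z ≢ y → z ∈ interior D
  ∈-interior⁺ D z∈ z≢x z≢y = ∈-filter⁺ _ z∈ (z≢x , z≢y)

  ∉-interior : ∀ D {z} → z ∈ interior D → z ≢ x × z ≢ y
  ∉-interior D {z} z∈ = proj₂ (∈-filter⁻ (λ z → ¬? (z ≟ᶠ x) ×-dec ¬? (z ≟ᶠ y)) {xs = vertices D} z∈)

  record Collected (i : ℕ) : Set where
    field
      detour : Fin i → Detour
      used : List (Fin n)
      |used| : length used ≤ i * (2 * t ∸ 2)
      x∉ : x ∉ used
      y∉ : y ∉ used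
      covers : ∀ p {z} → z ∈ vertices (detour p) → z ≡ x ⊎ z ≡ y ⊎ z ∈ used
      disjoint : ∀ p q → p ≢ q → InternallyDisjoint x y (vertices (detour p)) (vertices (detour q))

  collect : ∀ i → i ≤ k → Collected i
  collect zero _ = record { detour = λ () ; used = [] ; |used| = z≤n ; x∉ = λ () ; y∉ = λ ()
                          ; covers = λ () ; disjoint = λ () }
  collect (suc i) i<k = record
    { detour = detour′ ; used = interior D ++ used ; |used| = |used|′ ; x∉ = x∉′ ; y∉ = y∉′
    ; covers = covers′ ; disjoint = disjoint′ }
    where
    open Collected (collect i (≤-trans (n≤1+n i) i<k))
    next = detour-avoiding used (≤-trans |used| (≤-trans (*-monoˡ-≤ (2 * t ∸ 2) (∸-monoˡ-≤ 1 i<k)) budget)) x∉ y∉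
    D = proj₁ next
    D-avoids = proj₂ next
    detour′ : Fin (suc i) → Detour
    detour′ zero = D
    detour′ (suc p) = detour p
    |used|′ : length (interior D ++ used) ≤ suc i * (2 * t ∸ 2)
    |used|′ = ≤-trans (≤-reflexive (length-++ (interior D))) (+-mono-≤ (length-interior D) |used|)
    x∉′ : x ∉ interior D ++ used
    x∉′ m with ∈-++⁻ (interior D) m
    ... | inj₁ x∈ = proj₁ (∉-interior D x∈) refl
    ... | inj₂ x∈ = x∉ x∈
    y∉′ : y ∉ interior D ++ used
    y∉′ m with ∈-++⁻ (interior D) m
    ... | inj₁ y∈ = proj₂ (∉-interior D y∈) refl
    ... | inj₂ y∈ = y∉ y∈
    covers′ : ∀ p {z} → z ∈ vertices (detour′ p) → z ≡ x ⊎ z ≡ y ⊎ z ∈ interior D ++ used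
    covers′ zero {z} z∈ with z ≟ᶠ x | z ≟ᶠ y
    ... | yes e | _ = inj₁ e
    ... | no _ | yes e = inj₂ (inj₁ e)
    ... | no z≢x | no z≢y = inj₂ (inj₂ (∈-++⁺ˡ (∈-interior⁺ D z∈ z≢x z≢y)))
    covers′ (suc p) z∈ with covers p z∈
    ... | inj₂ (inj₂ z∈used) = inj₂ (inj₂ (∈-++⁺ʳ (interior D) z∈used))
    ... | inj₁ e = inj₁ e
    ... | inj₂ (inj₁ e) = inj₂ (inj₁ e)
    new-disjoint : ∀ p z → z ∈ vertices D → z ∈ vertices (detour p) → z ≡ x ⊎ z ≡ y
    new-disjoint p z z∈D z∈p with covers p z∈p
    ... | inj₁ e = inj₁ e
    ... | inj₂ (inj₁ e) = inj₂ e
    ... | inj₂ (inj₂ z∈used) = ⊥-elim (All.lookup D-avoids z∈D z∈used)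
    disjoint′ : ∀ p q → p ≢ q → InternallyDisjoint x y (vertices (detour′ p)) (vertices (detour′ q))
    disjoint′ zero zero p≢q = ⊥-elim (p≢q refl)
    disjoint′ zero (suc q) _ z z∈D z∈q = new-disjoint q z z∈D z∈q
    disjoint′ (suc p) zero _ z z∈p z∈D = new-disjoint p z z∈D z∈p
    disjoint′ (suc p) (suc q) p≢q = disjoint p q (λ e → p≢q (cong suc e))

  detours : Fin k → Detour
  detours = Collected.detour (collect k ≤-refl)

  route : Fin k → List (Fin n)
  route i = vertices (detours i)

  detours-disjoint : ∀ p q → p ≢ q → InternallyDisjoint x y (route p) (route q)
  detours-disjoint = Collected.disjoint (collect k ≤-refl)

  edges : Detour → List (Edge n)
  edges D = walk-edges w 1 d (walk D)

  weight-edges : ∀ D → weight w (edges D) ≤ 2 * t * w x y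
  weight-edges D = ≤-trans
    (bucket-walk-weight d w (w x y) j (edges D) xy∈ (All.map proj₂ (walk-edges-in-bucket w 1 d (walk D))) |edges|≤d)
    (≤-reflexive (cong (_* w x y) (m∸n+n≡m 1≤2t)))
    where
    |edges|≤d : length (edges D) ≤ d
    |edges|≤d = ∸-monoˡ-≤ 1 (≤-trans (≤-reflexive (length-walk-edges w 1 d (walk D))) (short D))

-- Rerouting an optimal solution through H

module _ {n : ℕ} where

  private
    V = Fin n

  Linked-join : ∀ {R : V → V → Set} {Ok : V → V → Set} {xs ys u v} →
    IsWalk R xs u v → Linked Ok xs → Linked Ok (v ∷ ys) → Linked Ok (xs ++ ys)
  Linked-join single _ rest = rest
  Linked-join (step _ single) (ok ∷ _) rest = ok ∷ rest
  Linked-join (step _ (step r w)) (ok ∷ oks) rest = ok ∷ Linked-join (step r w) oks rest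

  Linked-reverse : ∀ {R : V → V → Set} {Ok : V → V → Set} →
    (∀ {p q} → R p q → R q p) → (∀ {p q} → Ok p q → Ok q p) → ∀ {xs u v} → IsWalk R xs u v → Linked Ok xs → Linked Ok (reverse xs)
  Linked-reverse R-sym Ok-sym single _ = [-]
  Linked-reverse {Ok = Ok} R-sym Ok-sym (step {u} {x} {xs} r w) (ok ∷ oks) =
    subst (Linked Ok) (sym (unfold-reverse u (x ∷ xs)))
      (Linked-join (walk-reverse R-sym w) (Linked-reverse R-sym Ok-sym w oks) (Ok-sym ok ∷ [-]))

  Linked-trivial : ∀ xs → Linked {A = V} (λ _ _ → ⊤) xs
  Linked-trivial [] = []
  Linked-trivial (x ∷ []) = [-]
  Linked-trivial (x ∷ y ∷ xs) = tt ∷ Linked-trivial (y ∷ xs)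

  module _ {a b : V} where

    NotStep-∉ : ∀ xs → All (a ≢_) xs → Linked (NotStep a b) xs
    NotStep-∉ [] _ = []
    NotStep-∉ (x ∷ []) _ = [-]
    NotStep-∉ (x ∷ y ∷ xs) (a≢x ∷ a≢y ∷ a≢) =
      ((λ (x≡a , _) → a≢x (sym x≡a)) , (λ (_ , y≡a) → a≢y (sym y≡a))) ∷ NotStep-∉ (y ∷ xs) (a≢y ∷ a≢)

    NotStep-nonadjacent : ∀ {H : List (Edge n)} {xs p q} → ¬ Adj H a b → IsWalk (Adj H) xs p q → Linked (NotStep a b) xs
    NotStep-nonadjacent ¬adj single = [-]
    NotStep-nonadjacent ¬adj (step r w) =
      ((λ { (refl , refl) → ¬adj r }) , (λ { (refl , refl) → ¬adj (Adj-sym r) })) ∷ NotStep-nonadjacent ¬adj w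

    -- A path from a to b other than the edge a b meets a only at its start and b only at its end.
    NotStep-path : ∀ {R : V → V → Set} {xs} → IsWalk R xs a b → Unique xs → a ≢ b → xs ≢ a ∷ b ∷ [] →
      Linked (NotStep a b) xs
    NotStep-path single _ a≢b _ = ⊥-elim (a≢b refl)
    NotStep-path (step _ single) _ _ ≢edge = ⊥-elim (≢edge refl)
    NotStep-path (step {x = x} {xs = rest} _ (step _ w)) (a∉ ∷ x∉ ∷ _) a≢b _ =
      ((λ (_ , x≡b) → All.lookup x∉ (walk-last w) x≡b) , (λ (a≡b , _) → a≢b a≡b)) ∷ NotStep-∉ (x ∷ rest) a∉

    NotStep⊎ends : ∀ xs → Linked (NotStep a b) xs ⊎ (a ∈ xs × b ∈ xs)
    NotStep⊎ends [] = inj₁ []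
    NotStep⊎ends (x ∷ []) = inj₁ [-]
    NotStep⊎ends (x ∷ y ∷ xs) with NotStep⊎ends (y ∷ xs)
    ... | inj₂ (a∈ , b∈) = inj₂ (there a∈ , there b∈)
    ... | inj₁ rest with (x ≟ᶠ a) ×-dec (y ≟ᶠ b) | (x ≟ᶠ b) ×-dec (y ≟ᶠ a)
    ...   | yes (refl , refl) | _ = inj₂ (here refl , there (here refl))
    ...   | no _ | yes (refl , refl) = inj₂ (there (here refl) , here refl)
    ...   | no ¬ab | no ¬ba = inj₁ ((¬ab , ¬ba) ∷ rest)

  reroute : ∀ {E H : List (Edge n)} {Ok : V → V → Set} {Good : V → Set} {Fine : V → V → Set} →
    (∀ {s t} → Adj E s t → Good s → Good t → Ok s t →
       Σ (List V) λ D → IsWalk (Adj H) D s t × All Good D × Linked Fine D) →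
    ∀ {P s v} → IsWalk (Adj E) P s v → All Good P → Linked Ok P →
    Σ (List V) λ W → IsWalk (Adj H) W s v × All Good W × Linked Fine W
  reroute replace single good _ = _ , single , good , [-]
  reroute replace (step r w) (good-s ∷ good) (ok ∷ oks)
    with replace r good-s (All.lookup good (walk-head w)) ok | reroute replace w good oks
  ... | D , wD , goodD , fineD | _ , single , _ , _ = D , wD , goodD , fineD
  ... | D , wD , goodD , fineD | _ , step r′ w′ , _ ∷ goodW , fineW =
    _ , walk-++ wD (step r′ w′) , All-++⁺ goodD goodW , Linked-join wD fineD fineW

  HitsInterior : List V → V → V → List V → Set
  HitsInterior Z p q = Any (λ z → z ∈ Z × z ≢ p × z ≢ q)

  hitsInterior? : ∀ Z p q xs → Dec (HitsInterior Z p q xs)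
  hitsInterior? Z p q = Any.any? (λ z → (z ∈? Z) ×-dec (¬? (z ≟ᶠ p) ×-dec ¬? (z ≟ᶠ q)))

  ¬HitsInterior⇒Allowed : ∀ {a b Z p q xs} → Allowed a b Z p → Allowed a b Z q → ¬ HitsInterior Z p q xs →
    All (Allowed a b Z) xs
  ¬HitsInterior⇒Allowed {xs = []} _ _ _ = []
  ¬HitsInterior⇒Allowed {p = p} {q} {x ∷ xs} ok-p ok-q ¬hit = ok-x ∷ ¬HitsInterior⇒Allowed ok-p ok-q (λ h → ¬hit (there h))
    where
    ok-x : Allowed _ _ _ x
    ok-x with x ≟ᶠ p | x ≟ᶠ q
    ... | yes refl | _ = ok-p
    ... | no _ | yes refl = ok-q
    ... | no x≢p | no x≢q = inj₂ (inj₂ (λ x∈Z → ¬hit (here (x∈Z , x≢p , x≢q))))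

  module _ {Z : List V} {p q : V} {m : ℕ} (ps : Fin m → List V)
    (disjoint : ∀ i j → i ≢ j → InternallyDisjoint p q (ps i) (ps j)) where

    private
      hit-position : ∀ {xs} → HitsInterior Z p q xs → Fin (length Z)
      hit-position h = let (_ , _ , z∈Z , _) = find h in index z∈Z

      hit-position-injective : ∀ i j (hi : HitsInterior Z p q (ps i)) (hj : HitsInterior Z p q (ps j)) →
        hit-position hi ≡ hit-position hj → i ≡ j
      hit-position-injective i j hi hj eq with find hi | find hj | i ≟ᶠ j
      ... | _ | _ | yes i≡j = i≡j
      ... | z , z∈i , z∈Z , z≢p , z≢q | z′ , z′∈j , z′∈Z , _ | no i≢j
        with disjoint i j i≢j z z∈i (subst (_∈ ps j) (sym z≡z′) z′∈j)
        where
        z≡z′ : z ≡ z′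
        z≡z′ = trans (lookup-index z∈Z) (trans (cong (lookup Z) eq) (sym (lookup-index z′∈Z)))
      ...   | inj₁ z≡p = ⊥-elim (z≢p z≡p)
      ...   | inj₂ z≡q = ⊥-elim (z≢q z≡q)

    -- Each vertex of Z lies inside at most one of the lists.
    some-avoids-interior : length Z < m → Σ (Fin m) λ i → ¬ HitsInterior Z p q (ps i)
    some-avoids-interior = pigeonhole-unblocked _ (λ i → hitsInterior? Z p q (ps i)) (λ i → hit-position) hit-position-injective

    some-avoids-interior-and : (Bad : Fin m → Set) → (∀ i → Dec (Bad i)) → (∀ i j → Bad i → Bad j → i ≡ j) →
      suc (length Z) < m → Σ (Fin m) λ i → ¬ HitsInterior Z p q (ps i) × ¬ Bad i
    some-avoids-interior-and Bad Bad? Bad-unique |Z|<m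
      with pigeonhole-unblocked (λ i → HitsInterior Z p q (ps i) ⊎ Bad i) (λ i → hitsInterior? Z p q (ps i) ⊎-dec Bad? i)
                           label label-injective |Z|<m
      where
      label : ∀ i → HitsInterior Z p q (ps i) ⊎ Bad i → Fin (suc (length Z))
      label i (inj₁ h) = suc (hit-position h)
      label i (inj₂ _) = zero
      label-injective : ∀ i j bi bj → label i bi ≡ label j bj → i ≡ j
      label-injective i j (inj₁ hi) (inj₁ hj) eq = hit-position-injective i j hi hj (suc-injectiveᶠ eq)
      label-injective i j (inj₂ bi) (inj₂ bj) _ = Bad-unique i j bi bj
      label-injective i j (inj₁ _) (inj₂ _) ()
      label-injective i j (inj₂ _) (inj₁ _) ()
    ... | i , neither = i , (λ h → neither (inj₁ h)) , (λ b → neither (inj₂ b))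

weight-++ : ∀ {n} (w : Fin n → Fin n → ℕ) xs ys → weight w (xs ++ ys) ≡ weight w xs + weight w ys
weight-++ w xs ys = trans (cong sum (map-++ _ xs ys)) (sum-++ (map _ xs) _)

weight-concat-tabulate : ∀ {n} (w : Fin n → Fin n → ℕ) {m} (g : Fin m → List (Edge n)) B →
  (∀ i → weight w (g i) ≤ B) → weight w (concat (tabulate g)) ≤ m * B
weight-concat-tabulate w {zero} g B _ = z≤n
weight-concat-tabulate w {suc m} g B g≤ = ≤-trans (≤-reflexive (weight-++ w (g zero) _))
  (+-mono-≤ (g≤ zero) (weight-concat-tabulate w (λ i → g (suc i)) B (λ i → g≤ (suc i))))

module _ {a} {A : Set a} (f : A → ℕ) where

  private
    remove : ∀ {x} {L : List A} → x ∈ L →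
      Σ (List A) λ L′ → sum (map f L) ≡ f x + sum (map f L′) × (∀ {y} → y ∈ L → y ≢ x → y ∈ L′)
    remove (here refl) = _ , refl , λ { (here refl) y≢x → ⊥-elim (y≢x refl) ; (there m) _ → m }
    remove {x} {z ∷ L} (there x∈) with remove x∈
    ... | L′ , eq , rest = z ∷ L′ , trans (cong (f z +_) eq) (swap (f z) (f x) _) ,
                           λ { (here refl) _ → here refl ; (there m) y≢x → there (rest m y≢x) }
      where
      swap : ∀ a b c → a + (b + c) ≡ b + (a + c)
      swap = solve-∀

  sum-map-mono-⊆ₘ : ∀ {xs L : List A} → Unique xs → xs ⊆ₘ L → sum (map f xs) ≤ sum (map f L)
  sum-map-mono-⊆ₘ {[]} _ _ = z≤n
  sum-map-mono-⊆ₘ {x ∷ xs} (x∉ ∷ u) xs⊆ with remove (xs⊆ (here refl))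
  ... | L′ , eq , rest = ≤-trans
    (+-monoʳ-≤ (f x) (sum-map-mono-⊆ₘ u (λ m → rest (xs⊆ (there m)) (λ e → All.lookup x∉ m (sym e)))))
    (≤-reflexive (sym eq))

module Spanner {n : ℕ} (w : Fin n → Fin n → ℕ) {t k : ℕ} (1≤t : 1 ≤ t) (H : List (Edge n)) where

  record Rejected (x y : Fin n) : Set where
    field
      kept : List (Edge n)
      kept⊆H : kept ⊆ₘ H
      x≢y : x ≢ y
      bucket : ℕ
      in-bucket : InBucket 1 (2 * t ∸ 1) (w x y) bucket
      rejected : ¬ AddTest w t ((2 * t ∸ 2) * (k ∸ 1)) 1 (2 * t ∸ 1) kept (x , y)

  Witness : Edge n → Set
  Witness e = e ∈ H ⊎ Rejected (proj₁ e) (proj₂ e)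

  module DetoursOf {x y : Fin n} (r : Rejected x y) =
    Detours w {k = k} 1≤t (≤-reflexive (*-comm (k ∸ 1) (2 * t ∸ 2)))
            (Rejected.x≢y r) (Rejected.in-bucket r) (Rejected.rejected r)

  replacement : ∀ {e} → Witness e → List (Edge n)
  replacement {e} (inj₁ _) = [ e ]
  replacement (inj₂ r) = concat (tabulate (λ i → edges (detours i)))
    where open DetoursOf r

  weight-replacement : 1 ≤ k → ∀ {x y} (W : Witness (x , y)) → weight w (replacement W) ≤ 2 * t * k * w x y
  weight-replacement 1≤k {x} {y} (inj₁ _) = begin
    w x y + 0          ≡⟨ +-identityʳ (w x y) ⟩
    w x y              ≡⟨ *-identityˡ (w x y) ⟨
    1 * w x y          ≤⟨ *-monoˡ-≤ (w x y) (≤-trans (s≤s z≤n) (*-mono-≤ (*-monoʳ-≤ 2 1≤t) 1≤k)) ⟩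
    2 * t * k * w x y  ∎
    where open ≤-Reasoning
  weight-replacement _ {x} {y} (inj₂ r) = begin
    weight w (concat (tabulate (λ i → edges (detours i))))  ≤⟨ weight-concat-tabulate w _ _ (λ i → weight-edges (detours i)) ⟩
    k * (2 * t * w x y)                                      ≡⟨ reorder k t (w x y) ⟩
    2 * t * k * w x y                                        ∎
    where
    open DetoursOf r
    open ≤-Reasoning
    reorder : ∀ k t W → k * (2 * t * W) ≡ 2 * t * k * W
    reorder = solve-∀

  replacements : ∀ xs → (∀ {e} → e ∈ xs → Witness e) → List (Edge n)
  replacements [] _ = []
  replacements (e ∷ xs) witness = replacement (witness (here refl)) ++ replacements xs (λ m → witness (there m))

  replacement⊆replacements : ∀ xs (witness : ∀ {e} → e ∈ xs → Witness e) {e} (e∈ : e ∈ xs) →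
    replacement (witness e∈) ⊆ₘ replacements xs witness
  replacement⊆replacements (_ ∷ xs) witness (here refl) = ∈-++⁺ˡ
  replacement⊆replacements (_ ∷ xs) witness (there e∈) m =
    ∈-++⁺ʳ (replacement (witness (here refl))) (replacement⊆replacements xs (λ m → witness (there m)) e∈ m)

  weight-replacements : 1 ≤ k → ∀ xs (witness : ∀ {e} → e ∈ xs → Witness e) →
    weight w (replacements xs witness) ≤ 2 * t * k * weight w xs
  weight-replacements 1≤k [] _ = z≤n
  weight-replacements 1≤k ((x , y) ∷ xs) witness = begin
    weight w (replacement W ++ replacements xs _)            ≡⟨ weight-++ w (replacement W) _ ⟩
    weight w (replacement W) + weight w (replacements xs _)  ≤⟨ +-mono-≤ (weight-replacement 1≤k W) (weight-replacements 1≤k xs _) ⟩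
    2 * t * k * w x y + 2 * t * k * weight w xs              ≡⟨ *-distribˡ-+ (2 * t * k) (w x y) _ ⟨
    2 * t * k * (w x y + weight w xs)                        ∎
    where
    open ≤-Reasoning
    W = witness (here refl)

  module Restricted (OPT : List (Edge n)) (witness : ∀ {e} → e ∈ OPT → Witness e) where

    used? : ∀ e → Dec (e ∈ replacements OPT witness)
    used? e = Any.any? (e ≟ₑ_) (replacements OPT witness)

    H′ : List (Edge n)
    H′ = filter used? H

    H′-⊆ₘ : H′ ⊆ₘ replacements OPT witness
    H′-⊆ₘ m = proj₂ (∈-filter⁻ used? {xs = H} m)

    ∈-H′ : ∀ {e} → e ∈ H → e ∈ replacements OPT witness → e ∈ H′
    ∈-H′ e∈H used = ∈-filter⁺ used? e∈H used

    module _ {x y : Fin n} (r : Rejected x y) (used : replacement (inj₂ r) ⊆ₘ replacements OPT witness) where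
      open DetoursOf r

      detour-in-H′ : ∀ i → IsWalk (Adj H′) (route i) x y
      detour-in-H′ i = walk-map to-H′ (walk-along-edges w 1 (2 * t ∸ 1) (Detour.walk (detours i)))
        where
        edge-in-H′ : ∀ {e} → e ∈ edges (detours i) → e ∈ H′
        edge-in-H′ e∈ =
          ∈-H′ (Rejected.kept⊆H r (proj₁ (All.lookup (walk-edges-in-bucket w 1 (2 * t ∸ 1) (Detour.walk (detours i))) e∈)))
               (used (∈-concat⁺′ e∈ (∈-tabulate⁺ i)))
        to-H′ : ∀ {p q} → Adj (edges (detours i)) p q → Adj H′ p q
        to-H′ (inj₁ m) = inj₁ (edge-in-H′ m)
        to-H′ (inj₂ m) = inj₂ (edge-in-H′ m)

    -- Every edge x y of OPT is replaced by an x–y walk in H′ that uses no vertex of Z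
    -- besides x and y: among its k internally disjoint detours one misses Z, as |Z| < k.
    module Routing {a b : Fin n} (a≢b : a ≢ b) (Z : List (Fin n)) where

      private
        Good = Allowed a b Z

      route-edge : ∀ {x y} (W : Witness (x , y)) → replacement W ⊆ₘ replacements OPT witness → length Z < k →
        Good x → Good y → Σ (List (Fin n)) λ D → IsWalk (Adj H′) D x y × All Good D
      route-edge (inj₁ e∈H) used _ ok-x ok-y = _ , step (inj₁ (∈-H′ e∈H (used (here refl)))) single , ok-x ∷ ok-y ∷ []
      route-edge (inj₂ r) used |Z|<k ok-x ok-y
        with some-avoids-interior (λ i → route i) detours-disjoint |Z|<k
        where open DetoursOf r
      ... | i , ¬hit = _ , detour-in-H′ r used i , ¬HitsInterior⇒Allowed ok-x ok-y ¬hit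

      -- If x y is not the edge a b, at most one detour passes through both a and b.
      route-edge-avoiding-ab : ∀ {x y} (W : Witness (x , y)) → replacement W ⊆ₘ replacements OPT witness →
        suc (length Z) < k → Good x → Good y → NotStep a b x y →
        Σ (List (Fin n)) λ D → IsWalk (Adj H′) D x y × All Good D × Linked (NotStep a b) D
      route-edge-avoiding-ab (inj₁ e∈H) used _ ok-x ok-y xy-ok =
        _ , step (inj₁ (∈-H′ e∈H (used (here refl)))) single , ok-x ∷ ok-y ∷ [] , xy-ok ∷ [-]
      route-edge-avoiding-ab {x} {y} (inj₂ r) used |Z|<k ok-x ok-y xy-ok
        with some-avoids-interior-and (λ i → route i) detours-disjoint
               (λ i → a ∈ route i × b ∈ route i)
               (λ i → (a ∈? route i) ×-dec (b ∈? route i)) through-ab-unique |Z|<k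
        where
        open DetoursOf r
        through-ab-unique : ∀ i j → _ → _ → i ≡ j
        through-ab-unique i j (a∈i , b∈i) (a∈j , b∈j) with i ≟ᶠ j
        ... | yes i≡j = i≡j
        ... | no i≢j with detours-disjoint i j i≢j a a∈i a∈j | detours-disjoint i j i≢j b b∈i b∈j
        ...   | inj₁ a≡x | inj₁ b≡x = ⊥-elim (a≢b (trans a≡x (sym b≡x)))
        ...   | inj₁ a≡x | inj₂ b≡y = ⊥-elim (proj₁ xy-ok (sym a≡x , sym b≡y))
        ...   | inj₂ a≡y | inj₁ b≡x = ⊥-elim (proj₂ xy-ok (sym b≡x , sym a≡y))
        ...   | inj₂ a≡y | inj₂ b≡y = ⊥-elim (a≢b (trans a≡y (sym b≡y)))
      ... | i , ¬hit , ¬ab with NotStep⊎ends (DetoursOf.route r i)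
      ...   | inj₁ no-ab = _ , detour-in-H′ r used i , ¬HitsInterior⇒Allowed ok-x ok-y ¬hit , no-ab
      ...   | inj₂ through = ⊥-elim (¬ab through)

      private
        reverse-route : ∀ {Fine : Fin n → Fin n → Set} → (∀ {p q} → Fine p q → Fine q p) → ∀ {s t} →
          (Σ (List (Fin n)) λ D → IsWalk (Adj H′) D t s × All Good D × Linked Fine D) →
          Σ (List (Fin n)) λ D → IsWalk (Adj H′) D s t × All Good D × Linked Fine D
        reverse-route Fine-sym (D , wD , good , fine) =
          reverse D , walk-reverse Adj-sym wD , All-resp-⊇ reverse⁻ good , Linked-reverse Adj-sym Fine-sym wD fine

      route-step : ¬ Adj H′ a b → length Z < k → ∀ {s t} → Adj OPT s t → Good s → Good t → ⊤ →
        Σ (List (Fin n)) λ D → IsWalk (Adj H′) D s t × All Good D × Linked (NotStep a b) D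
      route-step ¬adj |Z|<k (inj₁ e∈) ok-s ok-t _ =
        let (D , wD , good) = route-edge (witness e∈) (replacement⊆replacements OPT witness e∈) |Z|<k ok-s ok-t
        in D , wD , good , NotStep-nonadjacent ¬adj wD
      route-step ¬adj |Z|<k (inj₂ e∈) ok-s ok-t _ = reverse-route NotStep-sym
        (let (D , wD , good) = route-edge (witness e∈) (replacement⊆replacements OPT witness e∈) |Z|<k ok-t ok-s
         in D , wD , good , NotStep-nonadjacent ¬adj wD)

      route-step-avoiding-ab : suc (length Z) < k → ∀ {s t} → Adj OPT s t → Good s → Good t → NotStep a b s t →
        Σ (List (Fin n)) λ D → IsWalk (Adj H′) D s t × All Good D × Linked (NotStep a b) D
      route-step-avoiding-ab |Z|<k (inj₁ e∈) ok-s ok-t st-ok =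
        route-edge-avoiding-ab (witness e∈) (replacement⊆replacements OPT witness e∈) |Z|<k ok-s ok-t st-ok
      route-step-avoiding-ab |Z|<k (inj₂ e∈) ok-s ok-t st-ok = reverse-route NotStep-sym
        (route-edge-avoiding-ab (witness e∈) (replacement⊆replacements OPT witness e∈) |Z|<k ok-t ok-s (NotStep-sym st-ok))

      -- Some of the m disjoint a–b paths of OPT misses Z, and its rerouting avoids Z in H′.
      avoidingWalk-nonadjacent : ¬ Adj H′ a b → ∀ {m} → HasDisjointPaths OPT a b m → length Z < m → m ≤ k →
        AvoidingWalk H′ a b Z
      avoidingWalk-nonadjacent ¬adj (ps , isPath , pairwise) |Z|<m m≤k
        with some-avoids-interior ps (λ i j i≢j → proj₂ (pairwise i j i≢j)) |Z|<m
      ... | i , ¬hit = reroute (route-step ¬adj (<-≤-trans |Z|<m m≤k)) (proj₁ (isPath i))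
                               (¬HitsInterior⇒Allowed (inj₁ refl) (inj₂ (inj₁ refl)) ¬hit) (Linked-trivial (ps i))

      -- The edge a b of OPT is at most one of the paths; it must not be used by the rerouting.
      avoidingWalk-adjacent : ∀ {m} → HasDisjointPaths OPT a b m → suc (length Z) < m → m ≤ k → AvoidingWalk H′ a b Z
      avoidingWalk-adjacent {m} (ps , isPath , pairwise) |Z|<m m≤k
        with some-avoids-interior-and ps (λ i j i≢j → proj₂ (pairwise i j i≢j)) (λ i → ps i ≡ a ∷ b ∷ [])
               (λ i → List-≡-dec _≟ᶠ_ (ps i) (a ∷ b ∷ [])) edge-unique |Z|<m
        where
        edge-unique : ∀ i j → ps i ≡ a ∷ b ∷ [] → ps j ≡ a ∷ b ∷ [] → i ≡ j
        edge-unique i j eqi eqj with i ≟ᶠ j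
        ... | yes i≡j = i≡j
        ... | no i≢j = ⊥-elim (proj₁ (pairwise i j i≢j) (trans eqi (sym eqj)))
      ... | i , ¬hit , ≢edge = reroute (route-step-avoiding-ab (<-≤-trans |Z|<m m≤k)) (proj₁ (isPath i))
                                 (¬HitsInterior⇒Allowed (inj₁ refl) (inj₂ (inj₁ refl)) ¬hit)
                                 (NotStep-path (proj₁ (isPath i)) (proj₂ (isPath i)) a≢b ≢edge)

    feasible : Loopless H′ → ∀ (r : Fin n → Fin n → ℕ) → Feasible OPT r → (∀ u v → u ≢ v → r u v ≤ k) →
      Feasible H′ r
    feasible loopless r OPT-feasible r≤k u v u≢v with Adj? H′ u v
    ... | yes adj = disjointPaths-adjacent loopless u≢v adj (r u v)
                      (λ Z |Z|<r → Routing.avoidingWalk-adjacent u≢v Z (OPT-feasible u v u≢v) |Z|<r (r≤k u v u≢v))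
    ... | no ¬adj = disjointPaths loopless u≢v (r u v)
                      (λ Z |Z|<r → Routing.avoidingWalk-nonadjacent u≢v Z ¬adj (OPT-feasible u v u≢v) |Z|<r (r≤k u v u≢v))

Unique-resp-⊆ : ∀ {a} {A : Set a} {xs ys : List A} → xs ⊆ ys → Unique ys → Unique xs
Unique-resp-⊆ [] u = u
Unique-resp-⊆ (_ ∷ʳ s) (_ ∷ u) = Unique-resp-⊆ s u
Unique-resp-⊆ (refl ∷ s) (y∉ ∷ u) = All-resp-⊆ s y∉ ∷ Unique-resp-⊆ s u

feasible-[] : ∀ {n} {r : Fin n → Fin n → ℕ} → (∀ u v → u ≢ v → r u v ≤ 0) → Feasible [] r
feasible-[] {r = r} r≤0 u v u≢v with r u v | r≤0 u v u≢v
... | zero | _ = (λ ()) , (λ ()) , (λ ())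

theorem3p2 : (n W t k : ℕ) (σ : List (Edge n)) (w : Fin n → Fin n → ℕ)
    (r : Fin n → Fin n → ℕ) (H : List (Edge n)) →
    SimpleEdgeList σ →
    (∀ a b → w a b ≡ w b a) →
    All (λ e → w (proj₁ e) (proj₂ e) ≤ W) σ →
    (∀ u v → r u v ≡ r v u) →
    IsMaxReq r k →
    1 ≤ t →
    Run w t ((2 * t ∸ 2) * (k ∸ 1)) 1 (2 * t ∸ 1) [] σ H →
    (OPT : List (Edge n)) → OPT ⊆ σ → Feasible OPT r →
    Σ (List (Edge n)) λ H' → H' ⊆ H × Feasible H' r ×
      weight w H' ≤ (2 * t * k) * weight w OPT
theorem3p2 n W t zero σ w r H _ _ _ _ (r≤0 , _) _ _ OPT _ _ = [] , minimum H , feasible-[] r≤0 , z≤n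
theorem3p2 n W t k@(suc _) σ w r H (loopless , unique , _) _ _ _ (r≤k , _) 1≤t run OPT OPT⊆σ OPT-feasible =
  H′ , filter-⊆ used? H , feasible (All-resp-⊆ H′⊆σ loopless) r OPT-feasible r≤k ,
  ≤-trans (sum-map-mono-⊆ₘ _ (Unique-resp-⊆ H′⊆σ unique) H′-⊆ₘ) (weight-replacements (s≤s z≤n) OPT witness)
  where
  open Spanner w {k = k} 1≤t H
  instance
    d-nonZero : NonZero (2 * t ∸ 1)
    d-nonZero = >-nonZero (∸-monoˡ-≤ 1 (*-monoʳ-≤ 2 1≤t))
  H⊆σ : H ⊆ σ
  H⊆σ with run-output w 1 (2 * t ∸ 1) run
  ... | ys , refl , ys⊆σ = ys⊆σ
  witness : ∀ {e} → e ∈ OPT → Witness e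
  witness {x , y} e∈ with run-rejected w 1 (2 * t ∸ 1) run (Any-resp-⊆ OPT⊆σ e∈)
  ... | inj₁ e∈H = inj₁ e∈H
  ... | inj₂ (kept , kept⊆H , rejected) = inj₂ record
    { kept = kept ; kept⊆H = kept⊆H ; x≢y = All.lookup loopless (Any-resp-⊆ OPT⊆σ e∈)
    ; bucket = proj₁ (inSomeBucket (2 * t ∸ 1) (w x y)) ; in-bucket = proj₂ (inSomeBucket (2 * t ∸ 1) (w x y))
    ; rejected = rejected }
  open Restricted OPT witness
  H′⊆σ : H′ ⊆ σ
  H′⊆σ = ⊆-trans (filter-⊆ used? H) H⊆σ
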